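{- For every $n\ge1$, there is a bijection between the set of block $n$-fountains of coins and $\mathcal{S}_n(321,\underline{21}43)$.
   Context: A block $n$-fountain of coins is an arrangement of coins (unit disks) in rows such that the bottom row consists of $n$ coins forming a contiguous block, and each higher row consists of a single contiguous block of coins in which each coin touches exactly two coins of the row beneath it. Permutations of $[n]$ are written in one-line notation. A permutation $\sigma$ contains $321$ if there are $i_1<i_2<i_3$ with $\sigma(i_1)>\sigma(i_2)>\sigma(i_3)$; it contains the vincular pattern $\underline{21}43$ if there are positions $i_1<i_2<i_3<i_4$ with $i_2=i_1+1$ and $\sigma(i_2)<\sigma(i_1)<\sigma(i_4)<\sigma(i_3)$. $\mathcal{S}_n(321,\underline{21}43)$ is the set of permutations of $[n]$ containing neither. -}

module Defs where

open import Data.Nat using (ℕ; suc; _+_; _<_; _≤_)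
open import Data.Fin as F using (Fin; toℕ)
open import Data.Vec using (Vec; lookup)
open import Data.Product using (∃-syntax; _×_)
open import Relation.Binary.PropositionalEquality using (_≡_)
open import Relation.Nullary using (¬_)

-- A fountain whose bottom row is a contiguous block of n
-- coins is either just that row (nothing on top), or has a second row which
-- is a contiguous block of m ≥ 1 coins, each touching exactly two coins of
-- the bottom row, i.e. the coins of the upper row sit in the "gaps"
-- j, j+1, …, j+m-1 between consecutive bottom coins (gap k = between bottom
-- coins k and k+1), so j + m ≤ n - 1, i.e. j + m < n; the rest of the
-- fountain is then a block fountain with bottom row of m coins.
data BlockFountain : ℕ → Set where
  bottomOnly : ∀ {n} → BlockFountain n
  stack      : ∀ {n} (j m : ℕ) → .(1 ≤ m) → .(j + m < n) →
               BlockFountain m → BlockFountain n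

Word : ℕ → Set
Word n = Vec (Fin n) n

IsPerm : ∀ {n} → Word n → Set
IsPerm {n} σ = ∀ (i j : Fin n) → lookup σ i ≡ lookup σ j → i ≡ j

Contains321 : ∀ {n} → Word n → Set
Contains321 {n} σ = ∃[ i₁ ] ∃[ i₂ ] ∃[ i₃ ]
  (i₁ F.< i₂ × i₂ F.< i₃ ×
   lookup σ i₂ F.< lookup σ i₁ × lookup σ i₃ F.< lookup σ i₂)

Contains21-43 : ∀ {n} → Word n → Set
Contains21-43 {n} σ = ∃[ i₁ ] ∃[ i₂ ] ∃[ i₃ ] ∃[ i₄ ]
  (toℕ i₂ ≡ suc (toℕ i₁) × i₂ F.< i₃ × i₃ F.< i₄ ×
   lookup σ i₂ F.< lookup σ i₁ × lookup σ i₁ F.< lookup σ i₄ ×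
   lookup σ i₄ F.< lookup σ i₃)

-- S_n(321, (21)43): a permutation is identified with its one-line word;
-- the side conditions are proof-irrelevant so equality is equality of words.
record Av321-2143 (n : ℕ) : Set where
  constructor perm
  field
    word     : Word n
    .isPerm  : IsPerm word
    .avoid₁  : ¬ Contains321 word
    .avoid₂  : ¬ Contains21-43 word

-- Call a word w on [0, m + d) admissible if it is a permutation avoiding 321 and (21)43 whose weak
-- excedances i ≤ w i all satisfy i + d ≤ w i; for d = 0 these are the words of S_n(321, (21)43).
-- A block fountain with bottom row of width m is encoded, recursively, by an admissible word of
-- length m + d: a single row gives d, …, m + d - 1, 0, …, d - 1, and a second row of m' coins
-- over the gaps j, …, j + m' - 1 contributes the run i ↦ i + d on the first j positions and on
-- the free gaps right of that row, around the encoding of the upper fountain at level d + 1.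
-- Decoding reads the runs back off: if w (m - 1) = m - 1 + d the last gap is free and position
-- m - 1 is deleted; otherwise the first break j of the initial run locates the upper row, and the
-- letters from j on, with the values ≥ d lowered by j, form an admissible word at level d + 1.
-- Both steps rest on the patterns forcing the word to ascend after its maximum and between its runs.

module Submission where

open import Defs
open import Data.Nat using (ℕ; _≤_)
open import Function.Bundles using (_⤖_)

open import Data.Empty using (⊥; ⊥-elim)
open import Data.Fin as F using (Fin; toℕ; fromℕ<)
open import Data.Fin.Properties using (toℕ-fromℕ<; fromℕ<-toℕ; toℕ<n; toℕ-injective; injective⇒≤; any?)
open import Data.Nat using (zero; suc; pred; _+_; _∸_; _<_; z≤n; s≤s; _≟_; _<?_; _≤?_; ≢-nonZero)
open import Data.Nat.Properties
open import Data.Nat.Tactic.RingSolver using (solve-∀)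
open import Data.Product using (Σ; _×_; _,_; proj₁; proj₂)
open import Data.Sum using (_⊎_; inj₁; inj₂)
open import Data.Vec using (Vec; lookup; tabulate)
open import Data.Vec.Properties using (lookup∘tabulate; tabulate∘lookup; tabulate-cong)
open import Function.Bundles using (mk↔ₛ′)
open import Function.Properties.Inverse using (↔⇒⤖)
open import Relation.Binary.Definitions using (tri<; tri≈; tri>)
open import Relation.Binary.PropositionalEquality
open import Relation.Nullary using (¬_; Dec; yes; no)
open import Relation.Nullary.Decidable.Core using (recompute)
open import Relation.Nullary.Recomputable using (⊥-recompute)

ifᵈ : ∀ {P : Set} → Dec P → ℕ → ℕ → ℕ
ifᵈ (yes _) a b = a
ifᵈ (no _)  a b = b

ifᵈ-yes : ∀ {P : Set} (x : Dec P) {a b} → P → ifᵈ x a b ≡ a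
ifᵈ-yes (yes _) _ = refl
ifᵈ-yes (no ¬p) p = ⊥-elim (¬p p)

ifᵈ-no : ∀ {P : Set} (x : Dec P) {a b} → ¬ P → ifᵈ x a b ≡ b
ifᵈ-no (yes p) ¬p = ⊥-elim (¬p p)
ifᵈ-no (no _)  _  = refl

+-right-comm : ∀ a b c → a + b + c ≡ a + c + b
+-right-comm = solve-∀

<⇒suc-pred : ∀ {a b} → a < b → suc (pred b) ≡ b
<⇒suc-pred {b = suc b} _ = refl

below-or-above : ∀ i m → i < m ⊎ Σ ℕ λ t → i ≡ m + t
below-or-above i m with i <? m
... | yes p = inj₁ p
... | no p  = inj₂ (i ∸ m , sym (m+[n∸m]≡n (≮⇒≥ p)))

tail-split : ∀ {p N} → p < N → Σ ℕ λ R → N ≡ suc p + R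
tail-split {p} {N} p<N = N ∸ suc p , sym (m+[n∸m]≡n p<N)

injective-interval-bound : ∀ a lo hi (f : ℕ → ℕ) → lo ≤ hi →
  (∀ i → i < a → lo ≤ f i) → (∀ i → i < a → f i < hi) →
  (∀ i i' → i < a → i' < a → f i ≡ f i' → i ≡ i') → a + lo ≤ hi
injective-interval-bound a lo hi f lo≤hi lower upper inj =
  subst (a + lo ≤_) (m∸n+n≡m lo≤hi) (+-monoˡ-≤ lo (injective⇒≤ g-injective))
  where
  g : Fin a → Fin (hi ∸ lo)
  g i = fromℕ< (∸-monoˡ-< (upper _ (toℕ<n i)) (lower _ (toℕ<n i)))
  g-injective : ∀ {i i'} → g i ≡ g i' → i ≡ i'
  g-injective {i} {i'} e = toℕ-injective (inj _ _ (toℕ<n i) (toℕ<n i')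
    (∸-cancelʳ-≡ (lower _ (toℕ<n i)) (lower _ (toℕ<n i'))
      (trans (sym (toℕ-fromℕ< _)) (trans (cong toℕ e) (toℕ-fromℕ< _)))))

Seq : Set
Seq = ℕ → ℕ

Bounded : ℕ → Seq → Set
Bounded N w = ∀ i → i < N → w i < N

InjectiveOn : ℕ → Seq → Set
InjectiveOn N w = ∀ i j → i < N → j < N → w i ≡ w j → i ≡ j

AgreeBelow : ℕ → Seq → Seq → Set
AgreeBelow N w w' = ∀ i → i < N → w i ≡ w' i

injective-surjective : ∀ N w → Bounded N w → InjectiveOn N w →
                       ∀ v → v < N → Σ ℕ λ i → i < N × w i ≡ v
injective-surjective N w bd inj v v<N with any? (λ (i : Fin N) → w (toℕ i) ≟ v)
... | yes (i , e) = toℕ i , toℕ<n i , e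
... | no missed = ⊥-elim (<-irrefl refl (subst (_≤ N) (+-identityʳ (suc N)) N+1≤N))
  where
  f : Seq
  f i = ifᵈ (i <? N) (w i) v
  hit : ∀ i → i < N → w i ≢ v
  hit i i<N e = missed (fromℕ< i<N , trans (cong w (toℕ-fromℕ< i<N)) e)
  f-bounded : ∀ i → i < suc N → f i < N
  f-bounded i _ with i <? N
  ... | yes p = bd i p
  ... | no _  = v<N
  f-injective : ∀ i i' → i < suc N → i' < suc N → f i ≡ f i' → i ≡ i'
  f-injective i i' p p' e with i <? N | i' <? N
  ... | yes a | yes b = inj i i' a b e
  ... | yes a | no b  = ⊥-elim (hit i a e)
  ... | no a  | yes b = ⊥-elim (hit i' b (sym e))
  ... | no a  | no b  = trans (≤-antisym (≤-pred p) (≮⇒≥ a)) (sym (≤-antisym (≤-pred p') (≮⇒≥ b)))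
  N+1≤N : suc N + 0 ≤ N
  N+1≤N = injective-interval-bound (suc N) 0 N f z≤n (λ _ _ → z≤n) f-bounded f-injective

Avoids321 : ℕ → Seq → Set
Avoids321 N w = ∀ i j k → i < j → j < k → k < N → w j < w i → w k < w j → ⊥

Avoids2143 : ℕ → Seq → Set
Avoids2143 N w = ∀ a c e → suc a < c → c < e → e < N → w (suc a) < w a → w a < w e → w e < w c → ⊥

ExcedanceGap : ℕ → ℕ → Seq → Set
ExcedanceGap d N w = ∀ i → i < N → i ≤ w i → i + d ≤ w i

record Admissible (d N : ℕ) (w : Seq) : Set where
  field
    bounded : Bounded N w
    injective : InjectiveOn N w
    avoids321 : Avoids321 N w
    avoids2143 : Avoids2143 N w
    gap : ExcedanceGap d N w

module AdmissibleFacts {d N : ℕ} {w : Seq} (A : Admissible d N w) where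
  open Admissible A public

  position : ℕ → ℕ
  position v with v <? N
  ... | yes v<N = proj₁ (injective-surjective N w bounded injective v v<N)
  ... | no _    = 0

  position-spec : ∀ v → v < N → position v < N × w (position v) ≡ v
  position-spec v v<N with v <? N
  ... | yes p = proj₂ (injective-surjective N w bounded injective v p)
  ... | no ¬p = ⊥-elim (¬p v<N)

  injective≢ : ∀ {x y} → x < N → y < N → x ≢ y → w x ≢ w y
  injective≢ x<N y<N x≢y e = x≢y (injective _ _ x<N y<N e)

  below-max : ∀ {p x} → suc (w p) ≡ N → p < N → x < N → x ≢ p → w x < w p
  below-max top p<N x<N x≢p =
    ≤∧≢⇒< (≤-pred (subst (w _ <_) (sym top) (bounded _ x<N))) (injective≢ x<N p<N x≢p)

  ascending-after-max : ∀ {p q₁ q₂} → suc (w p) ≡ N → p < q₁ → q₁ < q₂ → q₂ < N → w q₁ < w q₂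
  ascending-after-max {p} {q₁} {q₂} top h₁ h₂ h₃ with <-cmp (w q₁) (w q₂)
  ... | tri< x _ _ = x
  ... | tri≈ _ e _ = ⊥-elim (<-irrefl (injective q₁ q₂ (<-trans h₂ h₃) h₃ e) h₂)
  ... | tri> _ _ c = ⊥-elim (avoids321 p q₁ q₂ h₁ h₂ h₃
                       (below-max top (<-trans h₁ (<-trans h₂ h₃)) (<-trans h₂ h₃) (λ e → <-irrefl (sym e) h₁)) c)

  after-max-below-descent : ∀ {p a q} → suc (w p) ≡ N → suc a < p → w (suc a) < w a →
                            p < q → q < N → w q < w a
  after-max-below-descent {p} {a} {q} top h₁ h₂ h₃ h₄ with <-cmp (w q) (w a)
  ... | tri< x _ _ = x
  ... | tri≈ _ e _ = ⊥-elim (<-irrefl (sym (injective q a h₄ a<N e)) (<-trans a<p h₃))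
    where
    a<p = <-trans (n<1+n a) h₁
    a<N = <-trans a<p (<-trans h₃ h₄)
  ... | tri> _ _ c = ⊥-elim (avoids2143 a p q h₁ h₃ h₄ h₂ c
                       (below-max top (<-trans h₃ h₄) h₄ (λ e → <-irrefl (sym e) h₃)))

  below-first-ascending : ∀ x₁ x₂ → x₁ < x₂ → x₂ < N → w x₁ < w 0 → w x₂ < w 0 → w x₁ < w x₂
  below-first-ascending x₁ x₂ h₁ h₂ s₁ s₂ with <-cmp (w x₁) (w x₂)
  ... | tri< c _ _ = c
  ... | tri≈ _ c _ = ⊥-elim (<-irrefl (injective x₁ x₂ (<-trans h₁ h₂) h₂ c) h₁)
  ... | tri> _ _ c with x₁
  ...   | zero   = ⊥-elim (<-irrefl refl s₁)
  ...   | suc x₀ = ⊥-elim (avoids321 0 (suc x₀) x₂ (s≤s z≤n) h₁ h₂ s₁ c)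

  ascending-run-bound : ∀ s t → s + t < N → (∀ a → s ≤ a → suc a ≤ s + t → w a < w (suc a)) →
                        w s + t ≤ w (s + t)
  ascending-run-bound s zero _ _ = ≤-reflexive (trans (+-identityʳ (w s)) (cong w (sym (+-identityʳ s))))
  ascending-run-bound s (suc t) h asc =
    subst (λ u → w s + suc t ≤ w u) (sym (+-suc s t))
      (subst (_≤ w (suc (s + t))) (sym (+-suc (w s) t))
        (≤-trans (s≤s ih) (asc (s + t) (m≤m+n s t) (≤-reflexive (sym (+-suc s t))))))
    where
    ih : w s + t ≤ w (s + t)
    ih = ascending-run-bound s t (≤-<-trans (+-monoʳ-≤ s (n≤1+n t)) h)
           (λ a h₁ h₂ → asc a h₁ (≤-trans h₂ (+-monoʳ-≤ s (n≤1+n t))))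

  point-and-tail-bound : ∀ {i p R lo hi} → i ≤ p → N ≡ suc p + R → lo ≤ hi → lo ≤ w i → w i < hi →
                         (∀ s → s < R → lo ≤ w (suc p + s)) → (∀ s → s < R → w (suc p + s) < hi) →
                         suc R + lo ≤ hi
  point-and-tail-bound {i} {p} {R} {lo} {hi} i≤p N≡ lo≤hi lo≤wi wi<hi lower upper =
    injective-interval-bound (suc R) lo hi f lo≤hi f-lower f-upper f-injective
    where
    tail< : ∀ {s} → s < R → suc p + s < N
    tail< {s} sR = subst (suc p + s <_) (sym N≡) (+-monoʳ-< (suc p) sR)
    i<N : i < N
    i<N = subst (i <_) (sym N≡) (s≤s (≤-trans i≤p (m≤m+n p R)))
    i<tail : ∀ s → i < suc p + s
    i<tail s = s≤s (≤-trans i≤p (m≤m+n p s))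
    f : Seq
    f zero    = w i
    f (suc s) = w (suc p + s)
    f-lower : ∀ s → s < suc R → lo ≤ f s
    f-lower zero _     = lo≤wi
    f-lower (suc s) sR = lower s (≤-pred sR)
    f-upper : ∀ s → s < suc R → f s < hi
    f-upper zero _     = wi<hi
    f-upper (suc s) sR = upper s (≤-pred sR)
    f-injective : ∀ s s' → s < suc R → s' < suc R → f s ≡ f s' → s ≡ s'
    f-injective zero zero _ _ _ = refl
    f-injective zero (suc s') _ h' e = ⊥-elim (<-irrefl (injective i _ i<N (tail< (≤-pred h')) e) (i<tail s'))
    f-injective (suc s) zero h _ e = ⊥-elim (<-irrefl (injective i _ i<N (tail< (≤-pred h)) (sym e)) (i<tail s))
    f-injective (suc s) (suc s') h h' e =
      cong suc (+-cancelˡ-≡ (suc p) s s' (injective _ _ (tail< (≤-pred h)) (tail< (≤-pred h')) e))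

  run-point-bounds-prefix : ∀ p → p < N → w p ≡ p + d → ∀ i → i < p → w i < p + d
  run-point-bounds-prefix p p<N wp≡ i i<p with w i <? p + d
  ... | yes r = r
  ... | no r with tail-split p<N
  ...   | R , N≡ = ⊥-elim (<-irrefl refl (≤-trans (s≤s (m≤m+n (suc p + R) d))
                     (subst (_≤ suc p + R) (reorder R p d) (subst (suc R + suc (p + d) ≤_) N≡ count))))
    where
    reorder : ∀ R p d → suc R + suc (p + d) ≡ suc (suc p + R) + d
    reorder = solve-∀
    i<N = <-trans i<p p<N
    wi> : p + d < w i
    wi> = ≤∧≢⇒< (≮⇒≥ r) (λ e → <-irrefl (injective i p i<N p<N (trans (sym e) (sym wp≡))) i<p)
    tail< : ∀ {s} → s < R → suc p + s < N
    tail< {s} sR = subst (suc p + s <_) (sym N≡) (+-monoʳ-< (suc p) sR)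
    tail> : ∀ s → s < R → p + d < w (suc p + s)
    tail> s sR with <-cmp (w (suc p + s)) (w p)
    ... | tri< c _ _ = ⊥-elim (avoids321 i p _ i<p (s≤s (m≤m+n p s)) (tail< sR) (subst (_< w i) (sym wp≡) wi>) c)
    ... | tri≈ _ c _ = ⊥-elim (<-irrefl (sym (injective _ p (tail< sR) p<N c)) (s≤s (m≤m+n p s)))
    ... | tri> _ _ c = subst (_< w (suc p + s)) wp≡ c
    count : suc R + suc (p + d) ≤ N
    count = point-and-tail-bound (<⇒≤ i<p) N≡ (subst (_< N) wp≡ (bounded p p<N)) wi> (bounded i i<N)
              tail> (λ s sR → bounded _ (tail< sR))

-- Encoding

rotation : ℕ → ℕ → Seq
rotation m d i = ifᵈ (i <? m) (i + d) (i ∸ m)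

raise : ℕ → ℕ → ℕ → ℕ
raise d j x = ifᵈ (x <? d) x (x + j)

prefixRun : ℕ → ℕ → Seq → Seq
prefixRun d j z i = ifᵈ (i <? j) (i + d) (raise d j (z (i ∸ j)))

insertRun : ℕ → ℕ → ℕ → Seq → Seq
insertRun p r d y i = ifᵈ (i <? p) (y i) (ifᵈ (i <? p + r) (i + d) (y (i ∸ r)))

-- encode d F is a word of length m + d, m the width of the bottom row of F.  For a fountain F' on
-- m' coins over the gaps j, …, j + m' - 1 it is the run i ↦ i + d on the first j positions, then
-- encode (suc d) F' with its values ≥ d raised by j, with a further run for the m - (j + m' + 1)
-- gaps right of F' inserted before its last d letters.
encode : ℕ → ∀ {m} → BlockFountain m → Seq
encode d {m} bottomOnly = rotation m d
encode d {m} (stack j m' _ _ F) =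
  insertRun (j + suc m') (m ∸ (j + suc m')) d (prefixRun d j (encode (suc d) F))

-- The last d letters ascend and lie below every earlier descent top; this lets insertRun put a
-- run in front of them without creating a 321 or a (21)43.
record TailInvariant (m d : ℕ) (w : Seq) : Set where
  field
    tail-ascending      : ∀ q₁ q₂ → m ≤ q₁ → q₁ < q₂ → q₂ < m + d → w q₁ < w q₂
    tail-below-descents : ∀ a q → suc a ≤ m → w (suc a) < w a → m ≤ q → q < m + d → w q < w a

module _ {m d : ℕ} where
  rotation-lo : ∀ {i} → i < m → rotation m d i ≡ i + d
  rotation-lo {i} p = ifᵈ-yes (i <? m) p

  rotation-hi : ∀ t → rotation m d (m + t) ≡ t
  rotation-hi t = trans (ifᵈ-no ((m + t) <? m) (λ p → <-irrefl refl (≤-<-trans (m≤m+n m t) p))) (m+n∸m≡n m t)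

  private
    tail< : ∀ {t} → m + t < m + d → t < d
    tail< = +-cancelˡ-< m _ _

  rotation-bounded : Bounded (m + d) (rotation m d)
  rotation-bounded i i<N with below-or-above i m
  ... | inj₁ p rewrite rotation-lo p = +-monoˡ-< d p
  ... | inj₂ (t , refl) rewrite rotation-hi t = ≤-trans (tail< i<N) (m≤n+m d m)

  rotation-injective : InjectiveOn (m + d) (rotation m d)
  rotation-injective i i' i<N i'<N e with below-or-above i m | below-or-above i' m
  ... | inj₁ p | inj₁ p' rewrite rotation-lo p | rotation-lo p' = +-cancelʳ-≡ d i i' e
  ... | inj₁ p | inj₂ (t , refl) rewrite rotation-lo p | rotation-hi t =
        ⊥-elim (<-irrefl (sym e) (<-≤-trans (tail< i'<N) (m≤n+m d i)))
  ... | inj₂ (t , refl) | inj₁ p rewrite rotation-lo p | rotation-hi t =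
        ⊥-elim (<-irrefl e (<-≤-trans (tail< i<N) (m≤n+m d i')))
  ... | inj₂ (t , refl) | inj₂ (t' , refl) rewrite rotation-hi t | rotation-hi t' = cong (m +_) e

  rotation-avoids321 : Avoids321 (m + d) (rotation m d)
  rotation-avoids321 i j k i<j j<k k<N h₁ h₂ with below-or-above j m
  ... | inj₁ p rewrite rotation-lo p | rotation-lo (<-trans i<j p) = <-asym h₁ (+-monoˡ-< d i<j)
  ... | inj₂ (t , refl) with below-or-above k m
  ...   | inj₁ p = <-asym j<k (<-≤-trans p (m≤m+n m t))
  ...   | inj₂ (t' , refl) rewrite rotation-hi t | rotation-hi t' = <-asym h₂ (+-cancelˡ-< m _ _ j<k)

  rotation-avoids2143 : Avoids2143 (m + d) (rotation m d)
  rotation-avoids2143 a c e sa<c c<e e<N h₁ h₂ h₃ with below-or-above c m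
  ... | inj₁ p rewrite rotation-lo (<-trans sa<c p) | rotation-lo (<-trans (n<1+n a) (<-trans sa<c p)) =
        <-asym h₁ (+-monoˡ-< d (n<1+n a))
  ... | inj₂ (t , refl) with below-or-above e m
  ...   | inj₁ p = <-asym c<e (<-≤-trans p (m≤m+n m t))
  ...   | inj₂ (t' , refl) rewrite rotation-hi t | rotation-hi t' = <-asym h₃ (+-cancelˡ-< m _ _ c<e)

  rotation-gap : 1 ≤ m → ExcedanceGap d (m + d) (rotation m d)
  rotation-gap 1≤m i i<N h with below-or-above i m
  ... | inj₁ p rewrite rotation-lo p = ≤-refl
  ... | inj₂ (t , refl) rewrite rotation-hi t =
        ⊥-elim (<-irrefl refl (≤-<-trans h (<-≤-trans (n<1+n t) (+-monoˡ-≤ t 1≤m))))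

  rotation-tailInvariant : TailInvariant m d (rotation m d)
  rotation-tailInvariant = record { tail-ascending = ascending ; tail-below-descents = below }
    where
    ascending : ∀ q₁ q₂ → m ≤ q₁ → q₁ < q₂ → q₂ < m + d → rotation m d q₁ < rotation m d q₂
    ascending q₁ q₂ h₁ h₂ h₃ with below-or-above q₁ m | below-or-above q₂ m
    ... | inj₁ p | _ = ⊥-elim (<-irrefl refl (<-≤-trans p h₁))
    ... | _ | inj₁ p = ⊥-elim (<-irrefl refl (<-trans (<-≤-trans p h₁) h₂))
    ... | inj₂ (t , refl) | inj₂ (t' , refl) rewrite rotation-hi t | rotation-hi t' = +-cancelˡ-< m _ _ h₂
    below : ∀ a q → suc a ≤ m → rotation m d (suc a) < rotation m d a → m ≤ q → q < m + d →
            rotation m d q < rotation m d a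
    below a q sa≤m _ h₁ h₂ with below-or-above q m
    ... | inj₁ p = ⊥-elim (<-irrefl refl (<-≤-trans p h₁))
    ... | inj₂ (t , refl) rewrite rotation-hi t | rotation-lo sa≤m = ≤-trans (tail< h₂) (m≤n+m d a)

  rotation-admissible : 1 ≤ m → Admissible d (m + d) (rotation m d)
  rotation-admissible 1≤m = record
    { bounded = rotation-bounded ; injective = rotation-injective ; avoids321 = rotation-avoids321
    ; avoids2143 = rotation-avoids2143 ; gap = rotation-gap 1≤m }

module _ {d j : ℕ} where
  raise-lo : ∀ {x} → x < d → raise d j x ≡ x
  raise-lo {x} p = ifᵈ-yes (x <? d) p

  raise-hi : ∀ {x} → d ≤ x → raise d j x ≡ x + j
  raise-hi {x} p = ifᵈ-no (x <? d) (λ x<d → <-irrefl refl (<-≤-trans x<d p))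

  raise-mono : ∀ {x y} → x < y → raise d j x < raise d j y
  raise-mono {x} {y} x<y with x <? d | y <? d
  ... | yes _ | yes _  = x<y
  ... | yes _ | no _   = <-≤-trans x<y (m≤m+n y j)
  ... | no p  | yes q  = ⊥-elim (<-irrefl refl (<-≤-trans (<-trans x<y q) (≮⇒≥ p)))
  ... | no _  | no _   = +-monoˡ-< j x<y

  raise-reflects-< : ∀ {x y} → raise d j x < raise d j y → x < y
  raise-reflects-< {x} {y} h with <-cmp x y
  ... | tri< a _ _    = a
  ... | tri≈ _ refl _ = ⊥-elim (<-irrefl refl h)
  ... | tri> _ _ c    = ⊥-elim (<-asym h (raise-mono c))

  raise-injective : ∀ {x y} → raise d j x ≡ raise d j y → x ≡ y
  raise-injective {x} {y} h with <-cmp x y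
  ... | tri< a _ _ = ⊥-elim (<-irrefl h (raise-mono a))
  ... | tri≈ _ e _ = e
  ... | tri> _ _ c = ⊥-elim (<-irrefl (sym h) (raise-mono c))

  raise≤ : ∀ x → raise d j x ≤ x + j
  raise≤ x with x <? d
  ... | yes _ = m≤m+n x j
  ... | no _  = ≤-refl

  raise-small : ∀ x → raise d j x < j + d → x < d
  raise-small x h with x <? d
  ... | yes p = p
  ... | no p  = ⊥-elim (<-irrefl refl (<-≤-trans h (subst (_≤ x + j) (+-comm d j) (+-monoˡ-≤ j (≮⇒≥ p)))))

  run≢raise : ∀ {i} x → i < j → i + d ≢ raise d j x
  run≢raise {i} x i<j e with x <? d
  ... | yes p = <-irrefl (sym e) (<-≤-trans p (m≤n+m d i))
  ... | no p  = <-irrefl e (<-≤-trans (+-monoˡ-< d i<j) (subst (_≤ x + j) (+-comm d j) (+-monoˡ-≤ j (≮⇒≥ p))))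

  raise-gap : ∀ x t → (t ≤ x → t + suc d ≤ x) → j + t ≤ raise d j x → j + t + d ≤ raise d j x
  raise-gap x t gapₓ h with x <? d
  ... | yes p = ⊥-elim (<-irrefl refl (<-trans p (≤-trans (m≤n+m (suc d) t) (gapₓ (≤-trans (m≤n+m t j) h)))))
  ... | no p  = subst (_≤ x + j) (sym (trans (+-assoc j t d) (+-comm j (t + d))))
                  (+-monoˡ-≤ j (≤-trans (+-monoʳ-≤ t (n≤1+n d))
                    (gapₓ (+-cancelʳ-≤ j t x (subst (_≤ x + j) (+-comm j t) h)))))

  prefixRun-lo : ∀ {z i} → i < j → prefixRun d j z i ≡ i + d
  prefixRun-lo {z} {i} p = ifᵈ-yes (i <? j) p

  prefixRun-hi : ∀ {z} t → prefixRun d j z (j + t) ≡ raise d j (z t)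
  prefixRun-hi {z} t = trans (ifᵈ-no ((j + t) <? j) (λ p → <-irrefl refl (≤-<-trans (m≤m+n j t) p)))
                             (cong (λ u → raise d j (z u)) (m+n∸m≡n j t))

  prefixRun-hi′ : ∀ {z} t → prefixRun d j z (suc (j + t)) ≡ raise d j (z (suc t))
  prefixRun-hi′ {z} t = trans (cong (prefixRun d j z) (sym (+-suc j t))) (prefixRun-hi {z} (suc t))

  prefixRun-ascent : ∀ {z} → suc d ≤ z 0 → ∀ a → a < j → prefixRun d j z a < prefixRun d j z (suc a)
  prefixRun-ascent {z} z₀ a a<j with below-or-above (suc a) j
  ... | inj₁ p rewrite prefixRun-lo {z} p | prefixRun-lo {z} a<j = n<1+n _
  ... | inj₂ (t , e) = subst₂ _<_ (sym (prefixRun-lo {z} a<j)) (sym at-j)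
           (<-≤-trans (+-monoˡ-< d a<j) (subst (_≤ z 0 + j) (+-comm d j) (+-monoˡ-≤ j (≤-trans (n≤1+n d) z₀))))
    where
    t≡0 : t ≡ 0
    t≡0 = n≤0⇒n≡0 (+-cancelˡ-≤ j t 0 (subst (_≤ j + 0) e (subst (suc a ≤_) (sym (+-identityʳ j)) a<j)))
    at-j : prefixRun d j z (suc a) ≡ z 0 + j
    at-j = begin
      prefixRun d j z (suc a)  ≡⟨ cong (prefixRun d j z) e ⟩
      prefixRun d j z (j + t)  ≡⟨ prefixRun-hi {z} t ⟩
      raise d j (z t)          ≡⟨ cong (λ u → raise d j (z u)) t≡0 ⟩
      raise d j (z 0)          ≡⟨ raise-hi (≤-trans (n≤1+n d) z₀) ⟩
      z 0 + j                  ∎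
      where open ≡-Reasoning

module _ {d j m' : ℕ} {z : Seq} (A : Admissible (suc d) (m' + suc d) z)
         (I : TailInvariant m' (suc d) z) where
  private
    open AdmissibleFacts A
    open TailInvariant I
    M = m' + suc d
    w = prefixRun d j z
    z₀ : suc d ≤ z 0
    z₀ = gap 0 (≤-trans (s≤s z≤n) (m≤n+m (suc d) m')) z≤n
    length≡ : j + suc m' + d ≡ j + M
    length≡ = trans (+-assoc j (suc m') d) (cong (j +_) (sym (+-suc m' d)))
    offset< : ∀ {t} → j + t < j + suc m' + d → t < M
    offset< {t} h = +-cancelˡ-< j _ _ (subst (j + t <_) length≡ h)
    w-lo : ∀ {i} → i < j → w i ≡ i + d
    w-lo = prefixRun-lo {d} {j} {z}
    w-hi : ∀ t → w (j + t) ≡ raise d j (z t)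
    w-hi = prefixRun-hi {d} {j} {z}
    w-hi′ : ∀ t → w (suc (j + t)) ≡ raise d j (z (suc t))
    w-hi′ = prefixRun-hi′ {d} {j} {z}
    inside-run : ∀ {x t} → x < j → j + t ≤ x → ⊥
    inside-run p h = <-irrefl refl (<-≤-trans p (≤-trans (m≤m+n j _) h))

  prefixRun-bounded : Bounded (j + suc m' + d) w
  prefixRun-bounded i i<N with below-or-above i j
  ... | inj₁ p rewrite w-lo p = <-≤-trans (+-monoˡ-< d p) (+-monoˡ-≤ d (m≤m+n j (suc m')))
  ... | inj₂ (t , refl) rewrite w-hi t =
        ≤-<-trans (raise≤ (z t)) (subst (z t + j <_) (trans (+-comm M j) (sym length≡)) (+-monoˡ-< j (bounded t (offset< i<N))))

  prefixRun-injective : InjectiveOn (j + suc m' + d) w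
  prefixRun-injective i i' i<N i'<N e with below-or-above i j | below-or-above i' j
  ... | inj₁ p | inj₁ p' rewrite w-lo p | w-lo p' = +-cancelʳ-≡ d i i' e
  ... | inj₁ p | inj₂ (t' , refl) rewrite w-lo p | w-hi t' =
        ⊥-elim (run≢raise (z t') p e)
  ... | inj₂ (t , refl) | inj₁ p' rewrite w-lo p' | w-hi t =
        ⊥-elim (run≢raise (z t) p' (sym e))
  ... | inj₂ (t , refl) | inj₂ (t' , refl) rewrite w-hi t | w-hi t' =
        cong (j +_) (injective t t' (offset< i<N) (offset< i'<N) (raise-injective e))

  prefixRun-avoids321 : Avoids321 (j + suc m' + d) w
  prefixRun-avoids321 i i₂ k i<i₂ i₂<k k<N h₁ h₂ with below-or-above i₂ j
  ... | inj₁ p₂ rewrite w-lo p₂ | w-lo (<-trans i<i₂ p₂) =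
        <-asym h₁ (+-monoˡ-< d i<i₂)
  ... | inj₂ (t₂ , refl) with below-or-above k j
  ...   | inj₁ p₃ = ⊥-elim (inside-run p₃ (<⇒≤ i₂<k))
  ...   | inj₂ (t₃ , refl) with below-or-above i j
  ...     | inj₂ (t , refl)
          rewrite w-hi t | w-hi t₂ | w-hi t₃ =
        avoids321 t t₂ t₃ (+-cancelˡ-< j _ _ i<i₂) (+-cancelˡ-< j _ _ i₂<k) (offset< k<N)
          (raise-reflects-< h₁) (raise-reflects-< h₂)
  ...     | inj₁ p rewrite w-lo p | w-hi t₂ | w-hi t₃ =
        <-asym (raise-reflects-< h₂)
          (below-first-ascending t₂ t₃ (+-cancelˡ-< j _ _ i₂<k) (offset< k<N) (below-z₀ s₂) (below-z₀ s₃))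
    where
    below-z₀ : ∀ {x} → x < d → x < z 0
    below-z₀ x<d = <-trans x<d z₀
    s₂ : z t₂ < d
    s₂ = raise-small (z t₂) (<-trans h₁ (+-monoˡ-< d p))
    s₃ : z t₃ < d
    s₃ = <-trans (raise-reflects-< h₂) s₂

  prefixRun-avoids2143 : Avoids2143 (j + suc m' + d) w
  prefixRun-avoids2143 a c e sa<c c<e e<N h₁ h₂ h₃ with below-or-above a j
  ... | inj₁ p = <-asym h₁ (prefixRun-ascent {d} {j} {z} z₀ a p)
  ... | inj₂ (t , refl) with below-or-above c j | below-or-above e j
  ...   | inj₁ pc | _ = ⊥-elim (inside-run pc (<⇒≤ (<-trans (n<1+n _) sa<c)))
  ...   | _ | inj₁ pe = ⊥-elim (inside-run pe (<⇒≤ (<-trans (n<1+n _) (<-trans sa<c c<e))))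
  ...   | inj₂ (tc , refl) | inj₂ (te , refl) =
        avoids2143 t tc te (+-cancelˡ-< j _ _ (subst (_< j + tc) (sym (+-suc j t)) sa<c)) (+-cancelˡ-< j _ _ c<e)
          (offset< e<N)
          (raise-reflects-< (subst₂ _<_ (w-hi′ t) (w-hi t) h₁))
          (raise-reflects-< (subst₂ _<_ (w-hi t) (w-hi te) h₂))
          (raise-reflects-< (subst₂ _<_ (w-hi te) (w-hi tc) h₃))

  prefixRun-gap : ExcedanceGap d (j + suc m' + d) w
  prefixRun-gap i i<N h with below-or-above i j
  ... | inj₁ p rewrite w-lo p = ≤-refl
  ... | inj₂ (t , refl) rewrite w-hi t = raise-gap (z t) t (gap t (offset< i<N)) h

  prefixRun-tail-ascending : ∀ q₁ q₂ → j + suc m' ≤ q₁ → q₁ < q₂ → q₂ < j + suc m' + d → w q₁ < w q₂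
  prefixRun-tail-ascending q₁ q₂ h₁ h₂ h₃ with below-or-above q₁ j | below-or-above q₂ j
  ... | inj₁ p | _ = ⊥-elim (inside-run p h₁)
  ... | _ | inj₁ p = ⊥-elim (inside-run p (≤-trans h₁ (<⇒≤ h₂)))
  ... | inj₂ (t₁ , refl) | inj₂ (t₂ , refl) rewrite w-hi t₁ | w-hi t₂ =
        raise-mono (tail-ascending t₁ t₂ (≤-trans (n≤1+n m') (+-cancelˡ-≤ j _ _ h₁)) (+-cancelˡ-< j _ _ h₂) (offset< h₃))

  prefixRun-tail-below-descents : ∀ a q → suc a ≤ j + suc m' → w (suc a) < w a →
                                  j + suc m' ≤ q → q < j + suc m' + d → w q < w a
  prefixRun-tail-below-descents a q h₁ h₂ h₃ h₄ with below-or-above a j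
  ... | inj₁ p = ⊥-elim (<-asym h₂ (prefixRun-ascent {d} {j} {z} z₀ a p))
  ... | inj₂ (t , refl) with below-or-above q j
  ...   | inj₁ pq = ⊥-elim (inside-run pq h₃)
  ...   | inj₂ (tq , refl) = subst₂ _<_ (sym (w-hi tq)) (sym (w-hi t)) (raise-mono z-below)
    where
    descent : z (suc t) < z t
    descent = raise-reflects-< (subst₂ _<_ (w-hi′ t) (w-hi t) h₂)
    tq-lo : suc m' ≤ tq
    tq-lo = +-cancelˡ-≤ j _ _ h₃
    t≤m' : t ≤ m'
    t≤m' = ≤-pred (+-cancelˡ-≤ j _ _ (subst (_≤ j + suc m') (sym (+-suc j t)) h₁))
    z-below : z tq < z t
    z-below with m≤n⇒m<n∨m≡n t≤m'
    ... | inj₁ t<m' = tail-below-descents t tq t<m' descent (≤-trans (n≤1+n m') tq-lo) (offset< h₄)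
    ... | inj₂ refl = ⊥-elim (<-asym descent
                        (tail-ascending t (suc t) ≤-refl (n<1+n t) (≤-<-trans tq-lo (offset< h₄))))

  prefixRun-admissible : Admissible d (j + suc m' + d) w
  prefixRun-admissible = record
    { bounded = prefixRun-bounded ; injective = prefixRun-injective ; avoids321 = prefixRun-avoids321
    ; avoids2143 = prefixRun-avoids2143 ; gap = prefixRun-gap }

  prefixRun-tailInvariant : TailInvariant (j + suc m') d w
  prefixRun-tailInvariant = record
    { tail-ascending = prefixRun-tail-ascending ; tail-below-descents = prefixRun-tail-below-descents }

data RunView (p r i : ℕ) : Set where
  before : i < p → RunView p r i
  inside : (s : ℕ) → s < r → i ≡ p + s → RunView p r i
  after  : (t : ℕ) → i ≡ p + r + t → RunView p r i

runView : ∀ p r i → RunView p r i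
runView p r i with below-or-above i p
... | inj₁ x = before x
... | inj₂ (s , e) with s <? r
...   | yes x = inside s x e
...   | no x  = after (s ∸ r) (trans e (trans (cong (p +_) (sym (m+[n∸m]≡n (≮⇒≥ x)))) (sym (+-assoc p r (s ∸ r)))))

module InsertRun (p r d : ℕ) (y : Seq) where
  insertRun-before : ∀ {i} → i < p → insertRun p r d y i ≡ y i
  insertRun-before {i} x = ifᵈ-yes (i <? p) x

  insertRun-inside : ∀ s → s < r → insertRun p r d y (p + s) ≡ p + s + d
  insertRun-inside s s<r = trans (ifᵈ-no ((p + s) <? p) (λ h → <-irrefl refl (≤-<-trans (m≤m+n p s) h)))
                                 (ifᵈ-yes ((p + s) <? p + r) (+-monoʳ-< p s<r))

  insertRun-after : ∀ t → insertRun p r d y (p + r + t) ≡ y (p + t)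
  insertRun-after t =
    trans (ifᵈ-no ((p + r + t) <? p) (λ h → <-irrefl refl (≤-<-trans (≤-trans (m≤m+n p r) (m≤m+n (p + r) t)) h)))
      (trans (ifᵈ-no ((p + r + t) <? p + r) (λ h → <-irrefl refl (≤-<-trans (m≤m+n (p + r) t) h)))
        (cong y (trans (cong (_∸ r) (+-right-comm p r t)) (m+n∸n≡m (p + t) r))))

module _ {p d : ℕ} {y : Seq} (A : Admissible d (p + d) y) (I : TailInvariant p d y) (r : ℕ) where
  private
    open InsertRun p r d y
    open Admissible A
    open TailInvariant I
    w = insertRun p r d y
    after< : ∀ {t} → p + r + t < p + r + d → p + t < p + d
    after< h = +-monoʳ-< p (+-cancelˡ-< (p + r) _ _ h)
    p+d≤N : p + d ≤ p + r + d
    p+d≤N = +-monoˡ-≤ d (m≤m+n p r)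
    before< : ∀ {i} → i < p → i < p + d
    before< x = <-≤-trans x (m≤m+n p d)
    p+d≤inside : ∀ s → p + d ≤ p + s + d
    p+d≤inside s = +-monoˡ-≤ d (m≤m+n p s)
    y-before< : ∀ {i} → i < p → y i < p + d
    y-before< x = bounded _ (before< x)
    before<inside : ∀ {i} s → i < p → i < p + s
    before<inside s x = <-≤-trans x (m≤m+n p s)
    before<after : ∀ {i} t → i < p → i < p + r + t
    before<after t x = <-≤-trans x (≤-trans (m≤m+n p r) (m≤m+n (p + r) t))
    inside<after : ∀ {s} t → s < r → p + s < p + r + t
    inside<after t x = <-≤-trans (+-monoʳ-< p x) (m≤m+n (p + r) t)
    after≮inside : ∀ {t s} → s < r → p + r + t < p + s → ⊥
    after≮inside {t} x h = <-asym h (inside<after t x)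
    after≮before : ∀ {t i} → i < p → p + r + t < i → ⊥
    after≮before {t} x h = <-asym h (before<after t x)
    inside≮before : ∀ {s i} → i < p → p + s < i → ⊥
    inside≮before {s} x h = <-asym h (before<inside s x)
    after-offset< : ∀ {t t'} → p + r + t < p + r + t' → p + t < p + t'
    after-offset< h = +-monoʳ-< p (+-cancelˡ-< (p + r) _ _ h)
    inside<inside : ∀ {s s'} → p + s < p + s' → p + s + d < p + s' + d
    inside<inside h = +-monoˡ-< d h

  insertRun-bounded : Bounded (p + r + d) w
  insertRun-bounded i i<N with runView p r i
  ... | before x rewrite insertRun-before x = <-≤-trans (y-before< x) p+d≤N
  ... | inside s sr refl rewrite insertRun-inside s sr = +-monoˡ-< d (+-monoʳ-< p sr)
  ... | after t refl rewrite insertRun-after t = <-≤-trans (bounded _ (after< i<N)) p+d≤N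

  insertRun-injective : InjectiveOn (p + r + d) w
  insertRun-injective i i' i<N i'<N e with runView p r i | runView p r i'
  ... | before x | before x' rewrite insertRun-before x | insertRun-before x' =
        injective i i' (before< x) (before< x') e
  ... | before x | inside s' sr' refl rewrite insertRun-before x | insertRun-inside s' sr' =
        ⊥-elim (<-irrefl e (<-≤-trans (y-before< x) (p+d≤inside s')))
  ... | inside s sr refl | before x' rewrite insertRun-before x' | insertRun-inside s sr =
        ⊥-elim (<-irrefl (sym e) (<-≤-trans (y-before< x') (p+d≤inside s)))
  ... | before x | after t' refl rewrite insertRun-before x | insertRun-after t' =
        ⊥-elim (<-irrefl (injective i (p + t') (before< x) (after< i'<N) e) (before<inside t' x))
  ... | after t refl | before x' rewrite insertRun-before x' | insertRun-after t =
        ⊥-elim (<-irrefl (injective i' (p + t) (before< x') (after< i<N) (sym e)) (before<inside t x'))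
  ... | inside s sr refl | inside s' sr' refl rewrite insertRun-inside s sr | insertRun-inside s' sr' =
        +-cancelʳ-≡ d (p + s) (p + s') e
  ... | inside s sr refl | after t' refl rewrite insertRun-inside s sr | insertRun-after t' =
        ⊥-elim (<-irrefl (sym e) (<-≤-trans (bounded _ (after< i'<N)) (p+d≤inside s)))
  ... | after t refl | inside s' sr' refl rewrite insertRun-inside s' sr' | insertRun-after t =
        ⊥-elim (<-irrefl e (<-≤-trans (bounded _ (after< i<N)) (p+d≤inside s')))
  ... | after t refl | after t' refl rewrite insertRun-after t | insertRun-after t' =
        cong (p + r +_) (+-cancelˡ-≡ p t t' (injective (p + t) (p + t') (after< i<N) (after< i'<N) e))

  insertRun-avoids321 : Avoids321 (p + r + d) w
  insertRun-avoids321 i i2 k i<i2 i2<k k<N h₁ h₂ with runView p r i2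
  insertRun-avoids321 i i2 k i<i2 i2<k k<N h₁ h₂ | inside s2 sr2 refl with runView p r i
  ... | before x rewrite insertRun-before x | insertRun-inside s2 sr2 =
        <-asym h₁ (<-≤-trans (y-before< x) (p+d≤inside s2))
  ... | inside s sr refl rewrite insertRun-inside s sr | insertRun-inside s2 sr2 = <-asym h₁ (inside<inside i<i2)
  ... | after t refl = after≮inside sr2 i<i2
  insertRun-avoids321 i i2 k i<i2 i2<k k<N h₁ h₂ | before x2 with runView p r k
  ... | before x3 rewrite insertRun-before x3 | insertRun-before x2 | insertRun-before (<-trans i<i2 x2) =
        avoids321 i i2 k i<i2 i2<k (before< x3) h₁ h₂
  ... | inside s3 sr3 refl rewrite insertRun-before x2 | insertRun-inside s3 sr3 =
        <-asym h₂ (<-≤-trans (y-before< x2) (p+d≤inside s3))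
  ... | after t3 refl rewrite insertRun-before x2 | insertRun-before (<-trans i<i2 x2) | insertRun-after t3 =
        avoids321 i i2 (p + t3) i<i2 (before<inside t3 x2) (after< k<N) h₁ h₂
  insertRun-avoids321 i i2 k i<i2 i2<k k<N h₁ h₂ | after t2 refl with runView p r k
  ... | before x3 = after≮before x3 i2<k
  ... | inside s3 sr3 refl = after≮inside sr3 i2<k
  ... | after t3 refl with runView p r i
  ...   | before x rewrite insertRun-before x | insertRun-after t2 | insertRun-after t3 =
        avoids321 i (p + t2) (p + t3) (before<inside t2 x) (after-offset< i2<k) (after< k<N) h₁ h₂
  ...   | inside s sr refl rewrite insertRun-after t2 | insertRun-after t3 =
        <-asym h₂ (tail-ascending (p + t2) (p + t3) (m≤m+n p t2) (after-offset< i2<k) (after< k<N))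
  ...   | after t refl rewrite insertRun-after t | insertRun-after t2 | insertRun-after t3 =
        avoids321 (p + t) (p + t2) (p + t3) (after-offset< i<i2) (after-offset< i2<k) (after< k<N) h₁ h₂

  insertRun-avoids2143 : Avoids2143 (p + r + d) w
  insertRun-avoids2143 a c e sa<c c<e e<N h₁ h₂ h₃ with runView p r c
  insertRun-avoids2143 a c e sa<c c<e e<N h₁ h₂ h₃ | after tc refl with runView p r e
  ... | before xe = after≮before xe c<e
  ... | inside se sre refl = after≮inside sre c<e
  ... | after te refl rewrite insertRun-after tc | insertRun-after te =
        <-asym h₃ (tail-ascending (p + tc) (p + te) (m≤m+n p tc) (after-offset< c<e) (after< e<N))
  insertRun-avoids2143 a c e sa<c c<e e<N h₁ h₂ h₃ | before xc with runView p r e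
  ... | before xe
      rewrite insertRun-before xe | insertRun-before xc | insertRun-before (<-trans sa<c xc)
            | insertRun-before (<-trans (n<1+n a) (<-trans sa<c xc)) =
        avoids2143 a c e sa<c c<e (before< xe) h₁ h₂ h₃
  ... | inside se sre refl rewrite insertRun-before xc | insertRun-inside se sre =
        <-asym h₃ (<-≤-trans (y-before< xc) (p+d≤inside se))
  ... | after te refl
      rewrite insertRun-before xc | insertRun-after te | insertRun-before (<-trans sa<c xc)
            | insertRun-before (<-trans (n<1+n a) (<-trans sa<c xc)) =
        avoids2143 a c (p + te) sa<c (before<inside te xc) (after< e<N) h₁ h₂ h₃
  insertRun-avoids2143 a c e sa<c c<e e<N h₁ h₂ h₃ | inside sc src refl with runView p r e
  ... | before xe = inside≮before xe c<e
  ... | inside se sre refl rewrite insertRun-inside sc src | insertRun-inside se sre = <-asym h₃ (inside<inside c<e)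
  ... | after te refl with runView p r a | runView p r (suc a)
  ...   | after ta refl | _ = after≮inside src (<-trans (n<1+n _) sa<c)
  ...   | _ | after t1 e1 = after≮inside src (subst (_< p + sc) e1 sa<c)
  ...   | inside sa sra refl | before x1 = <-irrefl refl (<-trans (<-≤-trans x1 (m≤m+n p sa)) (n<1+n _))
  ...   | inside sa sra e0 | inside s1 sr1 e1 rewrite e0 | insertRun-inside sa sra =
        <-asym (subst (_< p + sa + d) (trans (cong w e1) (insertRun-inside s1 sr1)) h₁) (inside<inside (subst (p + sa <_) e1 (n<1+n _)))
  ...   | before xa | inside s1 sr1 e1 rewrite insertRun-before xa =
        <-asym h₁ (subst (y a <_) (sym (trans (cong w e1) (insertRun-inside s1 sr1))) (<-≤-trans (y-before< xa) (p+d≤inside s1)))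
  ...   | before xa | before x1 rewrite insertRun-before xa | insertRun-before x1 | insertRun-after te =
        <-asym h₂ (tail-below-descents a (p + te) (<⇒≤ x1) h₁ (m≤m+n p te) (after< e<N))

  insertRun-gap : ExcedanceGap d (p + r + d) w
  insertRun-gap i i<N h with runView p r i
  ... | before x rewrite insertRun-before x = gap i (before< x) h
  ... | inside s sr refl rewrite insertRun-inside s sr = ≤-refl
  ... | after t refl rewrite insertRun-after t = ⊥-elim (<-irrefl refl (<-≤-trans (bounded (p + t) (after< i<N))
          (≤-trans (+-monoˡ-≤ d (m≤m+n p t)) (gap (p + t) (after< i<N) (≤-trans (+-monoˡ-≤ t (m≤m+n p r)) h)))))

  insertRun-tail-ascending : ∀ q₁ q₂ → p + r ≤ q₁ → q₁ < q₂ → q₂ < p + r + d → w q₁ < w q₂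
  insertRun-tail-ascending q₁ q₂ h₁ h₂ h₃ with runView p r q₁ | runView p r q₂
  ... | before x | _ = ⊥-elim (<-irrefl refl (<-≤-trans x (≤-trans (m≤m+n p r) h₁)))
  ... | inside s sr refl | _ = ⊥-elim (<-irrefl refl (<-≤-trans (+-monoʳ-< p sr) h₁))
  ... | after t refl | before x = ⊥-elim (after≮before x h₂)
  ... | after t refl | inside s sr refl = ⊥-elim (after≮inside sr h₂)
  ... | after t refl | after t' refl rewrite insertRun-after t | insertRun-after t' =
        tail-ascending (p + t) (p + t') (m≤m+n p t) (after-offset< h₂) (after< h₃)

  insertRun-tail-below-descents : ∀ a q → suc a ≤ p + r → w (suc a) < w a → p + r ≤ q → q < p + r + d → w q < w a
  insertRun-tail-below-descents a q h₁ h₂ h₃ h₄ with runView p r q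
  ... | before x = ⊥-elim (<-irrefl refl (<-≤-trans x (≤-trans (m≤m+n p r) h₃)))
  ... | inside s sr refl = ⊥-elim (<-irrefl refl (<-≤-trans (+-monoʳ-< p sr) h₃))
  ... | after tq refl with runView p r a
  ...   | after ta refl = ⊥-elim (<-irrefl refl (≤-trans (s≤s (m≤m+n (p + r) ta)) h₁))
  ...   | inside sa sra refl rewrite insertRun-after tq | insertRun-inside sa sra =
        <-≤-trans (bounded _ (after< h₄)) (p+d≤inside sa)
  ...   | before xa with runView p r (suc a)
  ...     | inside s1 sr1 e1 rewrite insertRun-before xa =
        ⊥-elim (<-asym h₂ (subst (y a <_) (sym (trans (cong w e1) (insertRun-inside s1 sr1)))
                         (<-≤-trans (y-before< xa) (p+d≤inside s1))))
  ...     | before x1 rewrite insertRun-before xa | insertRun-before x1 | insertRun-after tq =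
        tail-below-descents a (p + tq) (<⇒≤ x1) h₂ (m≤m+n p tq) (after< h₄)
  ...     | after t1 e1 rewrite insertRun-before xa | insertRun-after tq =
        tail-below-descents a (p + tq) xa descent (m≤m+n p tq) (after< h₄)
    where
    r≡0 : r ≡ 0
    r≡0 = n≤0⇒n≡0 (+-cancelˡ-≤ p r 0 (subst (p + r ≤_) (sym (+-identityʳ p))
            (≤-trans (≤-trans (m≤m+n (p + r) t1) (≤-reflexive (sym e1))) xa)))
    sa≡ : suc a ≡ p + t1
    sa≡ = trans e1 (trans (cong (λ u → p + u + t1) r≡0) (cong (_+ t1) (+-identityʳ p)))
    descent : y (suc a) < y a
    descent = subst (_< y a) (trans (trans (cong w e1) (insertRun-after t1)) (cong y (sym sa≡))) h₂

  insertRun-admissible : Admissible d (p + r + d) w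
  insertRun-admissible = record
    { bounded = insertRun-bounded ; injective = insertRun-injective ; avoids321 = insertRun-avoids321
    ; avoids2143 = insertRun-avoids2143 ; gap = insertRun-gap }

  insertRun-tailInvariant : TailInvariant (p + r) d w
  insertRun-tailInvariant = record
    { tail-ascending = insertRun-tail-ascending ; tail-below-descents = insertRun-tail-below-descents }

upper-row-fits : ∀ {j m' m} → .(j + m' < m) → j + suc m' ≤ m
upper-row-fits {j} {m'} {m} h = subst (_≤ m) (sym (+-suc j m')) (recompute (suc (j + m') ≤? m) h)

encode-admissible : ∀ d m (F : BlockFountain m) → 1 ≤ m →
                    Admissible d (m + d) (encode d F) × TailInvariant m d (encode d F)
encode-admissible d m bottomOnly 1≤m = rotation-admissible 1≤m , rotation-tailInvariant
encode-admissible d m (stack j m' 1≤m' j+m'<m F) _ =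
  subst (λ k → Admissible d (k + d) w × TailInvariant k d w) (m+[n∸m]≡n P≤m)
    (insertRun-admissible A I r , insertRun-tailInvariant A I r)
  where
  P = j + suc m'
  r = m ∸ P
  w = encode d (stack j m' 1≤m' j+m'<m F)
  P≤m : P ≤ m
  P≤m = upper-row-fits j+m'<m
  IH = encode-admissible (suc d) m' F (recompute (1 ≤? m') 1≤m')
  A = prefixRun-admissible {d} {j} (proj₁ IH) (proj₂ IH)
  I = prefixRun-tailInvariant {d} {j} (proj₁ IH) (proj₂ IH)

-- Decoding

deleteAt : ℕ → Seq → Seq
deleteAt p w i = ifᵈ (i <? p) (w i) (w (suc i))

insertAt : ℕ → ℕ → Seq → Seq
insertAt p v u i = ifᵈ (i <? p) (u i) (ifᵈ (i ≟ p) v (u (pred i)))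

lowerAbove : ℕ → ℕ → ℕ → ℕ
lowerAbove d j x = ifᵈ (x <? d) x (x ∸ j)

dropPrefixRun : ℕ → ℕ → Seq → Seq
dropPrefixRun d j w t = lowerAbove d j (w (j + t))

widen : ∀ {m} → BlockFountain m → BlockFountain (suc m)
widen bottomOnly = bottomOnly
widen (stack j m' 1≤m' j+m'<m F) = stack j m' 1≤m' (m<n⇒m<1+n j+m'<m) F

data FirstBreak (d n : ℕ) (w : Seq) : Set where
  breakAt : (j m₂ : ℕ) → j + suc m₂ ≡ n → (∀ i → i < j → w i ≡ i + d) → w j ≢ j + d → FirstBreak d n w
  noBreak : (∀ i → i < n → w i ≡ i + d) → FirstBreak d n w

firstBreak : ∀ d n w → FirstBreak d n w
firstBreak d zero w = noBreak (λ _ ())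
firstBreak d (suc n) w with firstBreak d n w
... | breakAt j m₂ e run brk = breakAt j (suc m₂) (trans (+-suc j (suc m₂)) (cong suc e)) run brk
... | noBreak run with w n ≟ n + d
...   | no brk  = breakAt n 0 (+-comm n 1) run brk
...   | yes eq  = noBreak extended
  where
  extended : ∀ i → i < suc n → w i ≡ i + d
  extended i i<sn with m<1+n⇒m<n∨m≡n i<sn
  ... | inj₁ i<n  = run i i<n
  ... | inj₂ refl = eq

breakAt-unique : ∀ d (w : Seq) j j' → (∀ i → i < j → w i ≡ i + d) → w j ≢ j + d →
                 (∀ i → i < j' → w i ≡ i + d) → w j' ≢ j' + d → j' ≡ j
breakAt-unique d w j j' run brk run' brk' with <-cmp j' j
... | tri< x _ _ = ⊥-elim (brk' (run j' x))
... | tri≈ _ x _ = x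
... | tri> _ _ x = ⊥-elim (brk (run' j x))

-- decode k d m w inverts encode d on words of length m + d, using fuel k ≥ m.  If position m - 1
-- is on the run, it is a free gap to the right of the upper row; otherwise the upper row ends at
-- the last gap and starts at the first break j.
decode : ℕ → (d m : ℕ) → Seq → BlockFountain m
decode zero d m w = bottomOnly
decode (suc k) d zero w = bottomOnly
decode (suc k) d (suc zero) w = bottomOnly
decode (suc k) d (suc (suc m₀)) w with w (suc m₀) ≟ suc m₀ + d
... | yes _ = widen (decode k d (suc m₀) (deleteAt (suc m₀) w))
... | no _ with firstBreak d (suc m₀) w
...   | breakAt j m₂ e _ _ = stack j (suc m₂) (s≤s z≤n) (subst (_< suc (suc m₀)) (sym e) (n<1+n (suc m₀)))
                              (decode k (suc d) (suc m₂) (dropPrefixRun d j w))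
...   | noBreak _ = bottomOnly

module _ {p v : ℕ} {u : Seq} where
  insertAt-lo : ∀ {i} → i < p → insertAt p v u i ≡ u i
  insertAt-lo {i} x = ifᵈ-yes (i <? p) x

  insertAt-eq : insertAt p v u p ≡ v
  insertAt-eq = trans (ifᵈ-no (p <? p) (<-irrefl refl)) (ifᵈ-yes (p ≟ p) refl)

  insertAt-hi : ∀ {i} → p < i → insertAt p v u i ≡ u (pred i)
  insertAt-hi {i} x = trans (ifᵈ-no (i <? p) (<-asym x)) (ifᵈ-no (i ≟ p) (λ e → <-irrefl (sym e) x))

deleteAt-insertAt : ∀ p v u i → deleteAt p (insertAt p v u) i ≡ u i
deleteAt-insertAt p v u i with i <? p
... | yes _ = refl
... | no x  = insertAt-hi {p} {v} {u} (s≤s (≮⇒≥ x))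

deleteAt-cong : ∀ p n (w w' : Seq) → AgreeBelow (suc n) w w' → AgreeBelow n (deleteAt p w) (deleteAt p w')
deleteAt-cong p n w w' h i i<n with i <? p
... | yes _ = h i (m<n⇒m<1+n i<n)
... | no _  = h (suc i) (s≤s i<n)

insertRun-widen : ∀ P r d y i → insertRun P (suc r) d y i ≡ insertAt (P + r) (P + r + d) (insertRun P r d y) i
insertRun-widen P r d y i with runView P (suc r) i
... | before x =
      trans (before-wide x) (sym (trans (insertAt-lo {P + r} {P + r + d} {narrow} (<-≤-trans x (m≤m+n P r))) (before-narrow x)))
  where
  narrow = insertRun P r d y
  open InsertRun P (suc r) d y renaming (insertRun-before to before-wide)
  open InsertRun P r d y renaming (insertRun-before to before-narrow)
... | inside s sr refl with m<1+n⇒m<n∨m≡n sr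
...   | inj₁ s<r = trans (InsertRun.insertRun-inside P (suc r) d y s sr)
                     (sym (trans (insertAt-lo {P + r} {P + r + d} {insertRun P r d y} (+-monoʳ-< P s<r))
                                 (InsertRun.insertRun-inside P r d y s s<r)))
...   | inj₂ refl = trans (InsertRun.insertRun-inside P (suc r) d y s sr)
                      (sym (insertAt-eq {P + r} {P + r + d} {insertRun P r d y}))
insertRun-widen P r d y i | after t refl =
  trans (InsertRun.insertRun-after P (suc r) d y t)
    (sym (trans (insertAt-hi {P + r} {P + r + d} {insertRun P r d y} P+r<i)
           (trans (cong (λ x → insertRun P r d y (pred x)) shift) (InsertRun.insertRun-after P r d y t))))
  where
  shift : P + suc r + t ≡ suc (P + r + t)
  shift = cong (_+ t) (+-suc P r)
  P+r<i : P + r < P + suc r + t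
  P+r<i = subst (P + r <_) (sym shift) (s≤s (m≤m+n (P + r) t))

rotation-widen : ∀ m d i → rotation (suc m) d i ≡ insertAt m (m + d) (rotation m d) i
rotation-widen m d i with <-cmp i m
... | tri< x _ _ = trans (rotation-lo {suc m} {d} (m<n⇒m<1+n x))
                     (sym (trans (insertAt-lo {m} {m + d} {rotation m d} x) (rotation-lo {m} {d} x)))
... | tri≈ _ refl _ = trans (rotation-lo {suc m} {d} (n<1+n m)) (sym (insertAt-eq {m} {m + d} {rotation m d}))
... | tri> _ _ x = trans (ifᵈ-no (i <? suc m) (λ h → <-irrefl refl (<-≤-trans x (≤-pred h))))
                     (sym (trans (insertAt-hi {m} {m + d} {rotation m d} x)
                       (trans (ifᵈ-no (pred i <? m) (λ h → <-irrefl refl (<-≤-trans h pred-i≥m)))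
                         (∸-+-assoc i 1 m))))
  where
  pred-i≥m : m ≤ pred i
  pred-i≥m = ≤-pred (subst (suc m ≤_) (sym (<⇒suc-pred x)) x)

encode-widen : ∀ d {m} (F : BlockFountain m) i → encode d (widen F) i ≡ insertAt m (m + d) (encode d F) i
encode-widen d {m} bottomOnly i = rotation-widen m d i
encode-widen d {m} (stack j m' _ j+m'<m G) i = begin
  insertRun P (suc m ∸ P) d y i                  ≡⟨ cong (λ r → insertRun P r d y i) (+-∸-assoc 1 P≤m) ⟩
  insertRun P (suc (m ∸ P)) d y i                ≡⟨ insertRun-widen P (m ∸ P) d y i ⟩
  insertAt (P + (m ∸ P)) (P + (m ∸ P) + d) (insertRun P (m ∸ P) d y) i
    ≡⟨ cong (λ k → insertAt k (k + d) (insertRun P (m ∸ P) d y) i) (m+[n∸m]≡n P≤m) ⟩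
  insertAt m (m + d) (insertRun P (m ∸ P) d y) i ∎
  where
  open ≡-Reasoning
  P = j + suc m'
  y = prefixRun d j (encode (suc d) G)
  P≤m : P ≤ m
  P≤m = upper-row-fits j+m'<m

insertRun-empty : ∀ P d y i → insertRun P 0 d y i ≡ y i
insertRun-empty P d y i with i <? P
... | yes _ = refl
... | no i≮P with i <? P + 0
...   | yes i<P+0 = ⊥-elim (i≮P (subst (i <_) (+-identityʳ P) i<P+0))
...   | no _      = refl

lowerAbove-raise : ∀ d j x → lowerAbove d j (raise d j x) ≡ x
lowerAbove-raise d j x with x <? d
... | yes p = ifᵈ-yes (x <? d) p
... | no p  = trans (ifᵈ-no ((x + j) <? d) (λ h → p (≤-<-trans (m≤m+n x j) h))) (m+n∸n≡m x j)

raise-last≢run : ∀ {d j m'} {z : Seq} → Admissible (suc d) (m' + suc d) z → raise d j (z m') ≢ j + m' + d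
raise-last≢run {d} {j} {m'} {z} A e with z m' <? d
... | yes p = <-irrefl e (<-≤-trans p (m≤n+m d (j + m')))
... | no p  = <-irrefl refl (≤-trans (≤-reflexive (sym (+-suc m' d))) (subst (m' + suc d ≤_) zm'≡ gap-at-m'))
  where
  zm'≡ : z m' ≡ m' + d
  zm'≡ = +-cancelʳ-≡ j (z m') (m' + d)
           (trans e (trans (+-assoc j m' d) (+-comm j (m' + d))))
  gap-at-m' : m' + suc d ≤ z m'
  gap-at-m' = Admissible.gap A m' (subst (m' <_) (sym (+-suc m' d)) (s≤s (m≤m+n m' d)))
                (subst (m' ≤_) (sym zm'≡) (m≤m+n m' d))

deleteAt-encode-widen : ∀ d m (F : BlockFountain m) w → AgreeBelow (suc m + d) w (encode d (widen F)) →
                        AgreeBelow (m + d) (deleteAt m w) (encode d F)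
deleteAt-encode-widen d m F w hw i i<N = begin
  deleteAt m w i                                 ≡⟨ deleteAt-cong m (m + d) _ _ hw i i<N ⟩
  deleteAt m (encode d (widen F)) i              ≡⟨ deleteAt-cong m (m + d) _ _ (λ i' _ → encode-widen d F i') i i<N ⟩
  deleteAt m (insertAt m (m + d) (encode d F)) i ≡⟨ deleteAt-insertAt m (m + d) (encode d F) i ⟩
  encode d F i                                   ∎
  where open ≡-Reasoning

decode-widen : ∀ k d m₀ (F : BlockFountain (suc m₀)) w → AgreeBelow (suc (suc m₀) + d) w (encode d (widen F)) →
               decode k d (suc m₀) (deleteAt (suc m₀) w) ≡ F → decode (suc k) d (suc (suc m₀)) w ≡ widen F
decode-widen k d m₀ F w hw IH with w (suc m₀) ≟ suc m₀ + d
... | yes _ = cong widen IH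
... | no off-run = ⊥-elim (off-run (trans (hw (suc m₀) (≤-trans (n<1+n (suc m₀)) (m≤m+n (suc (suc m₀)) d)))
                                      (trans (encode-widen d F (suc m₀)) (insertAt-eq {suc m₀} {suc m₀ + d} {encode d F}))))

decode-tight : ∀ k d m₀ j m' .(p : 1 ≤ m') .(q : j + m' < suc (suc m₀)) (G : BlockFountain m') w →
  w (suc m₀) ≢ suc m₀ + d → j < suc m₀ → (∀ i → i < j → w i ≡ i + d) → w j ≢ j + d → j + m' ≡ suc m₀ →
  decode k (suc d) m' (dropPrefixRun d j w) ≡ G → decode (suc k) d (suc (suc m₀)) w ≡ stack j m' p q G
decode-tight k d m₀ j m' p q G w last-off j<m run brk j+m'≡ IH with w (suc m₀) ≟ suc m₀ + d
... | yes e = ⊥-elim (last-off e)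
... | no _ with firstBreak d (suc m₀) w
...   | noBreak run' = ⊥-elim (brk (run' j j<m))
...   | breakAt j' m₂ e run' brk' with breakAt-unique d w j j' run brk run' brk'
...     | refl with +-cancelˡ-≡ j (suc m₂) m' (trans e (sym j+m'≡))
...       | refl = cong (stack j (suc m₂) p q) IH

module AgreesWithPrefixRun {d m₀ j m' : ℕ} {z w : Seq} (A : Admissible (suc d) (m' + suc d) z) (1≤m' : 1 ≤ m')
                           (j+m'≡ : j + m' ≡ suc m₀) (w≈y : AgreeBelow (suc (suc m₀) + d) w (prefixRun d j z)) where
  private
    y = prefixRun d j z
    N = suc (suc m₀) + d
    m₀+1<N : suc m₀ < N
    m₀+1<N = ≤-trans (n<1+n (suc m₀)) (m≤m+n (suc (suc m₀)) d)
    z₀ : suc d ≤ z 0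
    z₀ = Admissible.gap A 0 (≤-trans (s≤s z≤n) (m≤n+m (suc d) m')) z≤n

  last-off : w (suc m₀) ≢ suc m₀ + d
  last-off e = raise-last≢run {d} {j} A (trans (sym (prefixRun-hi {d} {j} {z} m'))
                 (trans (cong y j+m'≡) (trans (sym (w≈y (suc m₀) m₀+1<N)) (trans e (cong (_+ d) (sym j+m'≡))))))

  j<m : j < suc m₀
  j<m = subst (j <_) j+m'≡ (subst (_≤ j + m') (+-comm j 1) (+-monoʳ-≤ j 1≤m'))

  private
    ≤j⇒<N : ∀ {i} → i ≤ j → i < N
    ≤j⇒<N h = <-trans (≤-<-trans h j<m) m₀+1<N

  run : ∀ i → i < j → w i ≡ i + d
  run i h = trans (w≈y i (≤j⇒<N (<⇒≤ h))) (prefixRun-lo {d} {j} {z} h)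

  brk : w j ≢ j + d
  brk e = <-irrefl (sym z0≡d) (<-≤-trans (n<1+n d) z₀)
    where
    wj≡ : w j ≡ z 0 + j
    wj≡ = trans (w≈y j (≤j⇒<N ≤-refl)) (trans (cong y (sym (+-identityʳ j)))
            (trans (prefixRun-hi {d} {j} {z} 0) (raise-hi {d} {j} (≤-trans (n≤1+n d) z₀))))
    z0≡d : z 0 ≡ d
    z0≡d = +-cancelʳ-≡ j (z 0) d (trans (sym wj≡) (trans e (+-comm j d)))

  dropPrefixRun-agrees : AgreeBelow (m' + suc d) (dropPrefixRun d j w) z
  dropPrefixRun-agrees t h = trans (cong (lowerAbove d j) w-jt) (lowerAbove-raise d j (z t))
    where
    jt<N : j + t < N
    jt<N = subst (j + t <_) (trans (sym (+-assoc j m' (suc d))) (trans (cong (_+ suc d) j+m'≡) (+-suc (suc m₀) d)))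
             (+-monoʳ-< j h)
    w-jt : w (j + t) ≡ raise d j (z t)
    w-jt = trans (w≈y (j + t) jt<N) (prefixRun-hi {d} {j} {z} t)

decode-encode-tight : ∀ k d m₀ j m' .(p : 1 ≤ m') .(q : j + m' < suc (suc m₀)) (G : BlockFountain m') w →
  j + suc m' ≡ suc (suc m₀) → 1 ≤ m' → AgreeBelow (suc (suc m₀) + d) w (encode d (stack j m' p q G)) →
  (∀ w' → AgreeBelow (m' + suc d) w' (encode (suc d) G) → decode k (suc d) m' w' ≡ G) →
  decode (suc k) d (suc (suc m₀)) w ≡ stack j m' p q G
decode-encode-tight k d m₀ j m' p q G w tight 1≤m' hw IH =
  decode-tight k d m₀ j m' p q G w last-off j<m run brk j+m'≡ (IH (dropPrefixRun d j w) dropPrefixRun-agrees)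
  where
  y = prefixRun d j (encode (suc d) G)
  no-free-gaps : suc (suc m₀) ∸ (j + suc m') ≡ 0
  no-free-gaps = trans (cong (_∸ (j + suc m')) (sym tight)) (n∸n≡0 (j + suc m'))
  w≈y : AgreeBelow (suc (suc m₀) + d) w y
  w≈y i h = trans (hw i h) (trans (cong (λ r → insertRun (j + suc m') r d y i) no-free-gaps)
                                  (insertRun-empty (j + suc m') d y i))
  j+m'≡ : j + m' ≡ suc m₀
  j+m'≡ = suc-injective (trans (sym (+-suc j m')) tight)
  open AgreesWithPrefixRun (proj₁ (encode-admissible (suc d) m' G 1≤m')) 1≤m' j+m'≡ w≈y

decode-encode : ∀ k d m (F : BlockFountain m) → 1 ≤ m → m ≤ k →
                ∀ w → AgreeBelow (m + d) w (encode d F) → decode k d m w ≡ F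
decode-encode zero d m F 1≤m m≤k w hw = ⊥-elim (<-irrefl refl (≤-trans 1≤m m≤k))
decode-encode (suc k) d zero F () m≤k w hw
decode-encode (suc k) d (suc zero) bottomOnly _ _ w hw = refl
decode-encode (suc k) d (suc zero) (stack j m' p q G) _ _ w hw =
  ⊥-elim (<-irrefl refl (≤-trans (recompute (1 ≤? m') p) (≤-trans (m≤n+m m' j) (≤-pred (recompute (suc (j + m') ≤? 1) q)))))
decode-encode (suc k) d (suc (suc m₀)) bottomOnly _ mk w hw =
  decode-widen k d m₀ bottomOnly w hw
    (decode-encode k d (suc m₀) bottomOnly (s≤s z≤n) (≤-pred mk) _ (deleteAt-encode-widen d (suc m₀) bottomOnly w hw))
decode-encode (suc k) d (suc (suc m₀)) (stack j m' p q G) _ mk w hw with m≤n⇒m<n∨m≡n (upper-row-fits q)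
... | inj₁ P<m = decode-widen k d m₀ F w hw
                   (decode-encode k d (suc m₀) F (s≤s z≤n) (≤-pred mk) _ (deleteAt-encode-widen d (suc m₀) F w hw))
  where
  F = stack j m' p (subst (_≤ suc m₀) (+-suc j m') (≤-pred P<m)) G
... | inj₂ P≡m = decode-encode-tight k d m₀ j m' p q G w P≡m 1≤m' hw (decode-encode k (suc d) m' G 1≤m' fuel)
  where
  1≤m' : 1 ≤ m'
  1≤m' = recompute (1 ≤? m') p
  fuel : m' ≤ k
  fuel = ≤-pred (≤-trans (subst (suc m' ≤_) P≡m (m≤n+m (suc m') j)) mk)

-- Admissible words are encodings

first≡d : ∀ {d w} → Admissible d (1 + d) w → w 0 ≡ d
first≡d A = ≤-antisym (≤-pred (Admissible.bounded A 0 (s≤s z≤n))) (Admissible.gap A 0 (s≤s z≤n) z≤n)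

admissible-single-row : ∀ d w → Admissible d (1 + d) w → AgreeBelow (1 + d) w (rotation 1 d)
admissible-single-row d w A zero _ = trans (first≡d A) (sym (rotation-lo {1} {d} (s≤s z≤n)))
admissible-single-row d w A (suc t) i<N = trans (≤-antisym upper lower) (sym (rotation-hi {1} {d} t))
  where
  open AdmissibleFacts A
  top : suc (w 0) ≡ suc d
  top = cong suc (first≡d A)
  ascent : ∀ a → 1 ≤ a → suc a < suc d → w a < w (suc a)
  ascent a h₁ h₂ = ascending-after-max top h₁ (n<1+n a) h₂
  lower : t ≤ w (suc t)
  lower = ≤-trans (m≤n+m t (w 1))
            (ascending-run-bound 1 t i<N (λ a h₁ h₂ → ascent a h₁ (s≤s (≤-trans h₂ (≤-pred i<N)))))
  upper : w (suc t) ≤ t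
  upper with below-or-above d (suc t)
  ... | inj₁ x = ⊥-elim (<-irrefl refl (<-≤-trans x (≤-pred i<N)))
  ... | inj₂ (k , e) =
        ≤-pred (+-cancelʳ-≤ k (suc (w (suc t))) (suc t) (≤-<-trans run-to-end (subst (w (suc t + k) <_) e last<d)))
    where
    end<N : suc t + k < suc d
    end<N = subst (_< suc d) e (n<1+n d)
    run-to-end : w (suc t) + k ≤ w (suc t + k)
    run-to-end = ascending-run-bound (suc t) k end<N
                   (λ a h₁ h₂ → ascent a (≤-trans (s≤s z≤n) h₁) (s≤s (subst (suc a ≤_) (sym e) h₂)))
    last<d : w (suc t + k) < d
    last<d = subst (w (suc t + k) <_) (first≡d A) (below-max top (s≤s z≤n) end<N (λ ()))

off-run-has-break : ∀ d m₀ w → Admissible d (suc (suc m₀) + d) w → w (suc m₀) ≢ suc m₀ + d →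
                    ¬ (∀ i → i < suc m₀ → w i ≡ i + d)
off-run-has-break d m₀ w A off run = at-max (position-spec T (n<1+n T))
  where
  open AdmissibleFacts A
  T = suc m₀ + d
  at-max : position T < suc T × w (position T) ≡ T → ⊥
  at-max (p<N , wp≡T) with <-cmp (position T) (suc m₀)
  ... | tri< x _ _ = <-irrefl (+-cancelʳ-≡ d _ _ (trans (sym (run _ x)) wp≡T)) x
  ... | tri≈ _ x _ = off (trans (cong w (sym x)) wp≡T)
  ... | tri> _ _ x = <-irrefl refl (<-≤-trans (+-monoˡ-< d x)
                       (subst (position T + d ≤_) wp≡T (gap (position T) p<N (subst (position T ≤_) (sym wp≡T) (≤-pred p<N)))))

skip : ℕ → ℕ → ℕ
skip m i = ifᵈ (i <? m) i (suc i)

deleteAt≡skip : ∀ m (w : Seq) i → deleteAt m w i ≡ w (skip m i)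
deleteAt≡skip m w i with i <? m
... | yes _ = refl
... | no _  = refl

skip-mono : ∀ m {i i'} → i < i' → skip m i < skip m i'
skip-mono m {i} {i'} h with i <? m | i' <? m
... | yes _ | yes _ = h
... | yes _ | no _  = m<n⇒m<1+n h
... | no x  | yes y = ⊥-elim (<-irrefl refl (<-≤-trans (<-trans h y) (≮⇒≥ x)))
... | no _  | no _  = s≤s h

skip-injective : ∀ m {i i'} → skip m i ≡ skip m i' → i ≡ i'
skip-injective m {i} {i'} e with <-cmp i i'
... | tri< x _ _ = ⊥-elim (<-irrefl e (skip-mono m x))
... | tri≈ _ x _ = x
... | tri> _ _ x = ⊥-elim (<-irrefl (sym e) (skip-mono m x))

skip≢ : ∀ m i → skip m i ≢ m
skip≢ m i with i <? m
... | yes x = λ e → <-irrefl e x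
... | no x  = λ e → <-irrefl (sym e) (s≤s (≮⇒≥ x))

skip< : ∀ m {i n} → i < n → skip m i < suc n
skip< m {i} h with i <? m
... | yes _ = m<n⇒m<1+n h
... | no _  = s≤s h

skip-≥ : ∀ m {i} → m ≤ i → skip m i ≡ suc i
skip-≥ m {i} h with i <? m
... | yes x = ⊥-elim (<-irrefl refl (<-≤-trans x h))
... | no _  = refl

skip-suc : ∀ m a → suc a ≢ m → skip m (suc a) ≡ suc (skip m a)
skip-suc m a ne with a <? m | suc a <? m
... | yes _ | yes _ = refl
... | yes x | no y  = ⊥-elim (ne (≤-antisym x (≮⇒≥ y)))
... | no x  | yes y = ⊥-elim (<-irrefl refl (<-≤-trans (<-trans (n<1+n a) y) (≮⇒≥ x)))
... | no _  | no _  = refl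

module _ {d m : ℕ} {w : Seq} (1≤m : 1 ≤ m) (A : Admissible d (suc m + d) w) (w-max : w m ≡ m + d) where
  private
    open AdmissibleFacts A
    N = suc m + d
    top : suc (w m) ≡ N
    top = cong suc w-max
    m<N : m < N
    m<N = s≤s (m≤m+n m d)
    below-m : ∀ {x} → x < m → x < N
    below-m x<m = <-trans x<m m<N
    y = deleteAt m w
    y≡ : ∀ i → y i ≡ w (skip m i)
    y≡ = deleteAt≡skip m w

  deleteAt-bounded : Bounded (m + d) y
  deleteAt-bounded i h = subst (_< m + d) (sym (y≡ i)) (subst (w (skip m i) <_) w-max (below-max top m<N (skip< m h) (skip≢ m i)))

  deleteAt-injective : InjectiveOn (m + d) y
  deleteAt-injective i i' h h' e =
    skip-injective m (injective _ _ (skip< m h) (skip< m h') (trans (sym (y≡ i)) (trans e (y≡ i'))))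

  deleteAt-avoids321 : Avoids321 (m + d) y
  deleteAt-avoids321 i k₁ k₂ h₁ h₂ h₃ d₁ d₂ =
    avoids321 (skip m i) (skip m k₁) (skip m k₂) (skip-mono m h₁) (skip-mono m h₂) (skip< m h₃)
      (subst₂ _<_ (y≡ k₁) (y≡ i) d₁) (subst₂ _<_ (y≡ k₂) (y≡ k₁) d₂)

  -- When suc a = m, the letters at c < e come after the maximum of w, where w ascends.
  deleteAt-avoids2143 : Avoids2143 (m + d) y
  deleteAt-avoids2143 a c e h₁ h₂ h₃ d₁ d₂ d₃ with suc a ≟ m
  ... | yes sa≡m = <-asym (subst₂ _<_ (y≡ e) (y≡ c) d₃)
                     (ascending-after-max top (subst (m <_) (sym (skip-≥ m m≤c)) (s≤s m≤c)) (skip-mono m h₂) (skip< m h₃))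
    where
    m≤c : m ≤ c
    m≤c = subst (_≤ c) sa≡m (<⇒≤ h₁)
  ... | no sa≢m = avoids2143 (skip m a) (skip m c) (skip m e)
                    (subst (_< skip m c) (skip-suc m a sa≢m) (skip-mono m h₁)) (skip-mono m h₂) (skip< m h₃)
                    (subst₂ _<_ (trans (y≡ (suc a)) (cong w (skip-suc m a sa≢m))) (y≡ a) d₁)
                    (subst₂ _<_ (y≡ a) (y≡ e) d₂) (subst₂ _<_ (y≡ e) (y≡ c) d₃)

  -- A weak excedance of y at m + t forces w q₀ = m + t for q₀ = m + t + 1.  Then the m letters
  -- before the maximum lie below m + t (by counting), ascend (by (21)43 with m and q₀) and are at
  -- least d: m distinct values in [d, m + t), which has fewer than m elements as t < d.
  private module ExcedanceAfterMax (t : ℕ) (h : m + t < m + d) (hy : m + t ≤ w (suc (m + t))) where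
    q₀ = suc (m + t)
    q₀<N : q₀ < N
    q₀<N = s≤s h
    m<q₀ : m < q₀
    m<q₀ = s≤s (m≤m+n m t)

    w-q₀ : w q₀ ≡ m + t
    w-q₀ = ≤-antisym (≤-pred below-diagonal) hy
      where
      below-diagonal : w q₀ < q₀
      below-diagonal with q₀ ≤? w q₀
      ... | no x  = ≰⇒> x
      ... | yes x = ⊥-elim (<-irrefl refl (<-≤-trans (≤-<-trans (+-monoˡ-≤ d (m≤m+n m t)) (n<1+n (m + t + d)))
                                             (≤-trans (gap q₀ q₀<N x) (≤-pred (bounded q₀ q₀<N)))))

    before-max-below : ∀ x → x < m → w x < m + t
    before-max-below x x<m with w x <? m + t
    ... | yes r = r
    ... | no r with tail-split q₀<N
    ...   | R , N≡ = ⊥-elim (<-irrefl refl (subst (_≤ q₀ + R) (cong suc (+-comm R q₀)) count))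
      where
      wx≥q₀ : q₀ ≤ w x
      wx≥q₀ = ≤∧≢⇒< (≮⇒≥ r) (λ e → <-irrefl (sym (injective q₀ x q₀<N (below-m x<m) (trans w-q₀ e))) (<-trans x<m m<q₀))
      m+d≡ : q₀ + R ≡ m + d
      m+d≡ = suc-injective (sym N≡)
      tail< : ∀ {s} → s < R → suc q₀ + s < N
      tail< {s} sR = subst (suc q₀ + s <_) (sym N≡) (+-monoʳ-< (suc q₀) sR)
      count : suc R + q₀ ≤ q₀ + R
      count = point-and-tail-bound (<⇒≤ (<-trans x<m m<q₀)) N≡ (m≤m+n q₀ R) wx≥q₀
                (subst (w x <_) (trans w-max (sym m+d≡)) (below-max top m<N (below-m x<m) (λ e → <-irrefl e x<m)))
                (λ s sR → subst (_≤ w (suc q₀ + s)) (cong suc w-q₀)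
                            (ascending-after-max top m<q₀ (≤-<-trans (m≤m+n q₀ s) (n<1+n _)) (tail< sR)))
                (λ s sR → subst (w (suc q₀ + s) <_) (trans w-max (sym m+d≡))
                            (below-max top m<N (tail< sR) (λ e → <-irrefl (sym e) (<-trans m<q₀ (≤-<-trans (m≤m+n q₀ s) (n<1+n _))))))

    before-max-ascending : ∀ a → suc a < m → w a < w (suc a)
    before-max-ascending a h₁ with <-cmp (w a) (w (suc a))
    ... | tri< x _ _ = x
    ... | tri≈ _ x _ =
          ⊥-elim (<-irrefl (injective a (suc a) (below-m (<-trans (n<1+n a) h₁)) (below-m h₁) x) (n<1+n a))
    ... | tri> _ _ x = ⊥-elim (avoids2143 a m q₀ h₁ m<q₀ q₀<N x
                         (subst (w a <_) (sym w-q₀) (before-max-below a (<-trans (n<1+n a) h₁)))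
                         (below-max top m<N q₀<N (λ e → <-irrefl (sym e) m<q₀)))

    before-max-above-d : ∀ x → x < m → d ≤ w x
    before-max-above-d x x<m = ≤-trans (gap 0 (below-m 1≤m) z≤n)
      (≤-trans (m≤m+n (w 0) x) (ascending-run-bound 0 x (below-m x<m) (λ a _ h₂ → before-max-ascending a (≤-<-trans h₂ x<m))))

    impossible : ⊥
    impossible = <-irrefl refl (<-≤-trans h
      (injective-interval-bound m d (m + t) w (<⇒≤ (≤-<-trans (before-max-above-d 0 1≤m) (before-max-below 0 1≤m)))
        before-max-above-d before-max-below (λ x x' h₁ h₂ → injective x x' (below-m h₁) (below-m h₂))))

  deleteAt-gap : ExcedanceGap d (m + d) y
  deleteAt-gap i h hy with below-or-above i m
  ... | inj₁ x = subst (i + d ≤_) (sym y≡w) (gap i (<-trans h (n<1+n _)) (subst (i ≤_) y≡w hy))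
    where
    y≡w : y i ≡ w i
    y≡w = trans (y≡ i) (cong w (ifᵈ-yes (i <? m) x))
  ... | inj₂ (t , refl) =
    ⊥-elim (ExcedanceAfterMax.impossible t h (subst (m + t ≤_) (trans (y≡ (m + t)) (cong w (skip-≥ m (m≤m+n m t)))) hy))

  deleteAt-admissible : Admissible d (m + d) y
  deleteAt-admissible = record
    { bounded = deleteAt-bounded ; injective = deleteAt-injective ; avoids321 = deleteAt-avoids321
    ; avoids2143 = deleteAt-avoids2143 ; gap = deleteAt-gap }

module AtFirstBreak (d m₀ : ℕ) (w : Seq) (A : Admissible d (suc (suc m₀) + d) w) (last-off : w (suc m₀) ≢ suc m₀ + d)
                    (j m₂ : ℕ) (j+m₂ : j + suc m₂ ≡ suc m₀) (run : ∀ i → i < j → w i ≡ i + d) (brk : w j ≢ j + d) where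
  open AdmissibleFacts A
  N = suc (suc m₀) + d
  T = suc m₀ + d

  p-max = position T

  p-max<N : p-max < N
  p-max<N = proj₁ (position-spec T (n<1+n T))

  w-p-max : w p-max ≡ T
  w-p-max = proj₂ (position-spec T (n<1+n T))

  top : suc (w p-max) ≡ N
  top = cong suc w-p-max

  p-max<m₀+1 : p-max < suc m₀
  p-max<m₀+1 = ≤∧≢⇒<
    (+-cancelʳ-≤ d p-max (suc m₀) (subst (p-max + d ≤_) w-p-max (gap p-max p-max<N (subst (p-max ≤_) (sym w-p-max) (≤-pred p-max<N)))))
    (λ e → last-off (trans (cong w (sym e)) w-p-max))

  j<m₀+1 : j < suc m₀
  j<m₀+1 = subst (j <_) j+m₂ (subst (_≤ j + suc m₂) (+-comm j 1) (+-monoʳ-≤ j (s≤s z≤n)))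

  j<N : j < N
  j<N = <-trans j<m₀+1 (m≤m+n (suc (suc m₀)) d)

  d≤w0 : d ≤ w 0
  d≤w0 = gap 0 (≤-trans (s≤s z≤n) p-max<N) z≤n

  tail-after-max-long : ∀ R → N ≡ suc p-max + R → R ≤ d → ⊥
  tail-after-max-long R N≡ R≤d = <-irrefl refl (<-≤-trans p-max<m₀+1
    (+-cancelʳ-≤ d (suc m₀) p-max (≤-pred (subst (_≤ suc p-max + d) (sym N≡) (+-monoʳ-≤ (suc p-max) R≤d)))))

  values-off-run : ∀ x → j ≤ x → x < N → w x < d ⊎ j + d ≤ w x
  values-off-run x j≤x x<N with w x <? d
  ... | yes s = inj₁ s
  ... | no s with w x <? j + d
  ...   | no b  = inj₂ (≮⇒≥ b)
  ...   | yes b = ⊥-elim (<-irrefl (injective (w x ∸ d) x (<-trans i<j j<N) x<N w-i≡) (<-≤-trans i<j j≤x))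
    where
    i<j : w x ∸ d < j
    i<j = subst (w x ∸ d <_) (m+n∸n≡m j d) (∸-monoˡ-< b (≮⇒≥ s))
    w-i≡ : w (w x ∸ d) ≡ w x
    w-i≡ = trans (run _ i<j) (m∸n+n≡m (≮⇒≥ s))

  -- A small value at j would make j - 1, j a descent above everything after the maximum, so all
  -- d + 1 or more letters after the maximum would be small.
  break-above-run : j + d < w j
  break-above-run with values-off-run j ≤-refl j<N
  ... | inj₂ h = ≤∧≢⇒< h (λ e → brk (sym e))
  ... | inj₁ small with j ≟ 0
  ...   | yes j≡0 = ⊥-elim (<-irrefl refl (<-≤-trans small (subst (λ u → d ≤ w u) (sym j≡0) d≤w0)))
  ...   | no j≢0 with tail-split p-max<N
  ...     | R , N≡ = ⊥-elim (tail-after-max-long R N≡ (subst (_≤ d) (+-identityʳ R) count))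
    where
    j₀ = pred j
    j₀+1≡j : suc j₀ ≡ j
    j₀+1≡j = suc-pred j {{≢-nonZero j≢0}}
    j₀<j : j₀ < j
    j₀<j = subst (j₀ <_) j₀+1≡j (n<1+n j₀)
    j<p-max : j < p-max
    j<p-max with <-cmp j p-max
    ... | tri< x _ _ = x
    ... | tri≈ _ x _ =
          ⊥-elim (<-irrefl refl (<-≤-trans small (subst (d ≤_) (trans (sym w-p-max) (cong w (sym x))) (m≤n+m d (suc m₀)))))
    ... | tri> _ _ x =
          ⊥-elim (<-irrefl (+-cancelʳ-≡ d p-max (suc m₀) (trans (sym (run p-max x)) w-p-max)) (<-trans x j<m₀+1))
    descent : w (suc j₀) < w j₀
    descent = subst₂ _<_ (cong w (sym j₀+1≡j)) (sym (run j₀ j₀<j)) (<-≤-trans small (m≤n+m d j₀))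
    after-max-small : ∀ x → p-max < x → x < N → w x < d
    after-max-small x h₁ h₂ with values-off-run x (<⇒≤ (<-trans j<p-max h₁)) h₂
    ... | inj₁ r = r
    ... | inj₂ r = ⊥-elim (<-irrefl refl (<-≤-trans
            (<-≤-trans (after-max-below-descent top (subst (_< p-max) (sym j₀+1≡j) j<p-max) descent h₁ h₂) (≤-reflexive (run j₀ j₀<j)))
            (≤-trans (+-monoˡ-≤ d (<⇒≤ j₀<j)) r)))
    tail< : ∀ {s} → s < R → suc p-max + s < N
    tail< {s} sR = subst (suc p-max + s <_) (sym N≡) (+-monoʳ-< (suc p-max) sR)
    count : R + 0 ≤ d
    count = injective-interval-bound R 0 d (λ s → w (suc p-max + s)) z≤n (λ _ _ → z≤n)
              (λ s sR → after-max-small _ (s≤s (m≤m+n p-max s)) (tail< sR))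
              (λ s s' h₁ h₂ e → +-cancelˡ-≡ (suc p-max) s s' (injective _ _ (tail< h₁) (tail< h₂) e))

  module _ (p : ℕ) (j<p : j < p) (p<N : p < N) (wp≡ : w p ≡ p + d) where
    private
      prefix-below : ∀ i → i < p → w i < p + d
      prefix-below = run-point-bounds-prefix p p<N wp≡
      p<m₀+1 : p < suc m₀
      p<m₀+1 = ≤∧≢⇒< (+-cancelʳ-≤ d p (suc m₀) (≤-pred (subst (_< N) wp≡ (bounded p p<N))))
                     (λ e → last-off (trans (cong w (sym e)) (trans wp≡ (cong (_+ d) e))))
      p<p-max : p < p-max
      p<p-max with <-cmp p p-max
      ... | tri< x _ _ = x
      ... | tri≈ _ x _ =
            ⊥-elim (<-irrefl (+-cancelʳ-≡ d p (suc m₀) (trans (sym wp≡) (trans (cong w x) w-p-max))) p<m₀+1)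
      ... | tri> _ _ x =
            ⊥-elim (<-irrefl refl (<-trans (subst (_< p + d) w-p-max (prefix-below p-max x)) (+-monoˡ-< d p<m₀+1)))

    -- A descent before p bounds the R > d letters after the maximum by p + d, as p does for the
    -- p letters before it: p + R distinct values below p + d.
    no-descent-before-run-point : ∀ a → suc a ≤ p → w (suc a) < w a → ⊥
    no-descent-before-run-point a sa≤p descent with tail-split p-max<N
    ... | R , N≡ = tail-after-max-long R N≡ (+-cancelˡ-≤ p R d (subst (_≤ p + d) (+-identityʳ (p + R)) count))
      where
      after-max-below : ∀ x → p-max < x → x < N → w x < p + d
      after-max-below x h₁ h₂ = <-trans (after-max-below-descent top (≤-<-trans sa≤p p<p-max) descent h₁ h₂) (prefix-below a sa≤p)
      f : Seq
      f s = ifᵈ (s <? p) (w s) (w (suc p-max + (s ∸ p)))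
      f-lo : ∀ {s} → s < p → f s ≡ w s
      f-lo {s} x = ifᵈ-yes (s <? p) x
      f-hi : ∀ u → f (p + u) ≡ w (suc p-max + u)
      f-hi u = trans (ifᵈ-no ((p + u) <? p) (λ h → <-irrefl refl (≤-<-trans (m≤m+n p u) h)))
                     (cong (λ k → w (suc p-max + k)) (m+n∸m≡n p u))
      tail< : ∀ {u} → u < R → suc p-max + u < N
      tail< {u} uR = subst (suc p-max + u <_) (sym N≡) (+-monoʳ-< (suc p-max) uR)
      prefix<tail : ∀ {s u} → s < p → s < suc p-max + u
      prefix<tail {s} {u} x = <-trans x (<-trans p<p-max (s≤s (m≤m+n p-max u)))
      f-bounded : ∀ s → s < p + R → f s < p + d
      f-bounded s h with below-or-above s p
      ... | inj₁ x = subst (_< p + d) (sym (f-lo x)) (prefix-below s x)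
      ... | inj₂ (u , refl) =
            subst (_< p + d) (sym (f-hi u)) (after-max-below _ (s≤s (m≤m+n p-max u)) (tail< (+-cancelˡ-< p _ _ h)))
      f-injective : ∀ s s' → s < p + R → s' < p + R → f s ≡ f s' → s ≡ s'
      f-injective s s' h h' e with below-or-above s p | below-or-above s' p
      ... | inj₁ x | inj₁ x' =
            injective s s' (<-trans x p<N) (<-trans x' p<N) (trans (sym (f-lo x)) (trans e (f-lo x')))
      ... | inj₁ x | inj₂ (u' , refl) = ⊥-elim (<-irrefl
              (injective s _ (<-trans x p<N) (tail< (+-cancelˡ-< p _ _ h')) (trans (sym (f-lo x)) (trans e (f-hi u')))) (prefix<tail x))
      ... | inj₂ (u , refl) | inj₁ x' = ⊥-elim (<-irrefl
              (injective s' _ (<-trans x' p<N) (tail< (+-cancelˡ-< p _ _ h)) (trans (sym (f-lo x')) (trans (sym e) (f-hi u)))) (prefix<tail x'))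
      ... | inj₂ (u , refl) | inj₂ (u' , refl) = cong (p +_) (+-cancelˡ-≡ (suc p-max) u u'
              (injective _ _ (tail< (+-cancelˡ-< p _ _ h)) (tail< (+-cancelˡ-< p _ _ h')) (trans (sym (f-hi u)) (trans e (f-hi u')))))
      count : p + R + 0 ≤ p + d
      count = injective-interval-bound (p + R) 0 (p + d) f z≤n (λ _ _ → z≤n) f-bounded f-injective

    -- From j to p the word ascends, so w p ≥ w j + (p - j) > p + d.
    no-run-point-after-break : ⊥
    no-run-point-after-break with below-or-above p j
    ... | inj₁ x = <-asym x j<p
    ... | inj₂ (t , p≡) =
          <-irrefl refl (<-≤-trans (subst (_< w j + t) (+-right-comm j d t) (+-monoˡ-< t break-above-run))
                                         (≤-trans rise (≤-reflexive (trans (cong w (sym p≡)) (trans wp≡ (cong (_+ d) p≡))))))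
      where
      j+t<N : j + t < N
      j+t<N = subst (_< N) p≡ p<N
      ascent : ∀ a → j ≤ a → suc a ≤ j + t → w a < w (suc a)
      ascent a _ h₂ with <-cmp (w a) (w (suc a))
      ... | tri< x _ _ = x
      ... | tri≈ _ x _ =
            ⊥-elim (<-irrefl (injective a (suc a) (<-trans (n<1+n a) (≤-<-trans h₂ j+t<N)) (≤-<-trans h₂ j+t<N) x) (n<1+n a))
      ... | tri> _ _ x = ⊥-elim (no-descent-before-run-point a (subst (suc a ≤_) (sym p≡) h₂) x)
      rise : w j + t ≤ w (j + t)
      rise = ascending-run-bound j t j+t<N ascent

  -- The values below a small w (j + t) sit strictly between j and j + t.
  small-value-bound : ∀ t → j + t < N → w (j + t) < d → w (j + t) < t
  small-value-bound t j+t<N small =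
    +-cancelʳ-< j _ _ (subst (w (j + t) + j <_) (+-comm j t) (subst (_≤ j + t) (+-suc (w (j + t)) j) count))
    where
    v = w (j + t)
    j<j+t : suc j ≤ j + t
    j<j+t with t ≟ 0
    ... | yes t≡0 = ⊥-elim (<-asym break-above-run
                      (<-≤-trans (subst (λ u → w u < d) (trans (cong (j +_) t≡0) (+-identityʳ j)) small) (m≤n+m d j)))
    ... | no t≢0 = subst (_≤ j + t) (+-comm j 1) (+-monoʳ-≤ j (≤∧≢⇒< z≤n (λ e → t≢0 (sym e))))
    u<N : ∀ {u} → u < v → u < N
    u<N h = <-trans h (bounded _ j+t<N)
    lower : ∀ u → u < v → suc j ≤ position u
    lower u h with position-spec u (u<N h)
    ... | _ , wp≡u with <-cmp (position u) j
    ...   | tri< x _ _ =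
          ⊥-elim (<-irrefl refl (<-≤-trans (<-trans h small) (subst (d ≤_) (trans (sym (run _ x)) wp≡u) (m≤n+m d (position u)))))
    ...   | tri≈ _ x _ =
          ⊥-elim (<-asym (<-trans h small) (subst (d <_) (trans (cong w (sym x)) wp≡u) (≤-<-trans (m≤n+m d j) break-above-run)))
    ...   | tri> _ _ x = x
    upper : ∀ u → u < v → position u < j + t
    upper u h with position-spec u (u<N h)
    ... | p<N , wp≡u with <-cmp (position u) (j + t)
    ...   | tri< x _ _ = x
    ...   | tri≈ _ x _ = ⊥-elim (<-irrefl (trans (sym wp≡u) (cong w x)) h)
    ...   | tri> _ _ x = ⊥-elim (<-asym h (subst (v <_) wp≡u (below-first-ascending (j + t) (position u) x p<N
                           (<-≤-trans small d≤w0) (<-≤-trans (subst (_< d) (sym wp≡u) (<-trans h small)) d≤w0))))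
    position-injective : ∀ u u' → u < v → u' < v → position u ≡ position u' → u ≡ u'
    position-injective u u' h h' e =
      trans (sym (proj₂ (position-spec u (u<N h)))) (trans (cong w e) (proj₂ (position-spec u' (u<N h'))))
    count : v + suc j ≤ j + t
    count = injective-interval-bound v (suc j) (j + t) position j<j+t lower upper position-injective

  M = suc m₂ + suc d
  z = dropPrefixRun d j w

  j+M≡N : j + M ≡ N
  j+M≡N = trans (sym (+-assoc j (suc m₂) (suc d))) (trans (cong (_+ suc d) j+m₂) (+-suc (suc m₀) d))

  shifted< : ∀ {t} → t < M → j + t < N
  shifted< {t} h = subst (j + t <_) j+M≡N (+-monoʳ-< j h)

  lowered : ∀ t → t < M → (w (j + t) < d × z t ≡ w (j + t)) ⊎ (j + d ≤ w (j + t) × z t + j ≡ w (j + t))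
  lowered t h with values-off-run (j + t) (m≤m+n j t) (shifted< h)
  ... | inj₁ s = inj₁ (s , ifᵈ-yes (w (j + t) <? d) s)
  ... | inj₂ b =
        inj₂ (b , trans (cong (_+ j) (ifᵈ-no (w (j + t) <? d) (λ s → <-irrefl refl (<-≤-trans s (≤-trans (m≤n+m d j) b)))))
                                 (m∸n+n≡m (≤-trans (m≤m+n j d) b)))

  raise-dropPrefixRun : ∀ t → t < M → raise d j (z t) ≡ w (j + t)
  raise-dropPrefixRun t h with lowered t h
  ... | inj₁ (s , e) = trans (raise-lo {d} {j} (subst (_< d) (sym e) s)) e
  ... | inj₂ (b , e) =
        trans (raise-hi {d} {j} (+-cancelʳ-≤ j d (z t) (subst (d + j ≤_) (sym e) (subst (_≤ w (j + t)) (+-comm j d) b)))) e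

  private
    lift< : ∀ {a b} → a < M → b < M → z a < z b → w (j + a) < w (j + b)
    lift< {a} {b} ha hb lt = subst₂ _<_ (raise-dropPrefixRun a ha) (raise-dropPrefixRun b hb) (raise-mono {d} {j} lt)

  dropPrefixRun-bounded : Bounded M z
  dropPrefixRun-bounded t h with lowered t h
  ... | inj₁ (s , e) = subst (_< M) (sym e) (<-trans s (≤-trans (n<1+n d) (m≤n+m (suc d) (suc m₂))))
  ... | inj₂ (b , e) =
        +-cancelʳ-< j _ _ (subst (z t + j <_) (trans (sym j+M≡N) (+-comm j M)) (subst (_< N) (sym e) (bounded _ (shifted< h))))

  dropPrefixRun-injective : InjectiveOn M z
  dropPrefixRun-injective t t' h h' e = +-cancelˡ-≡ j t t' (injective _ _ (shifted< h) (shifted< h')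
    (trans (sym (raise-dropPrefixRun t h)) (trans (cong (raise d j) e) (raise-dropPrefixRun t' h'))))

  dropPrefixRun-avoids321 : Avoids321 M z
  dropPrefixRun-avoids321 t₁ t₂ t₃ h₁ h₂ h₃ d₁ d₂ =
    avoids321 (j + t₁) (j + t₂) (j + t₃) (+-monoʳ-< j h₁) (+-monoʳ-< j h₂) (shifted< h₃)
      (lift< t₂<M (<-trans h₁ t₂<M) d₁) (lift< h₃ t₂<M d₂)
    where
    t₂<M = <-trans h₂ h₃

  dropPrefixRun-avoids2143 : Avoids2143 M z
  dropPrefixRun-avoids2143 a c e h₁ h₂ h₃ d₁ d₂ d₃ =
    avoids2143 (j + a) (j + c) (j + e) (subst (_< j + c) (+-suc j a) (+-monoʳ-< j h₁)) (+-monoʳ-< j h₂) (shifted< h₃)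
      (subst (λ u → w u < w (j + a)) (+-suc j a) (lift< sa<M a<M d₁)) (lift< a<M h₃ d₂) (lift< h₃ c<M d₃)
    where
    c<M = <-trans h₂ h₃
    sa<M = <-trans h₁ c<M
    a<M = <-trans (n<1+n a) sa<M

  dropPrefixRun-gap : ExcedanceGap (suc d) M z
  dropPrefixRun-gap t h t≤zt with lowered t h
  ... | inj₁ (s , e) = ⊥-elim (<-irrefl refl (<-≤-trans (small-value-bound t (shifted< h) s) (subst (t ≤_) e t≤zt)))
  ... | inj₂ (b , e) = +-cancelʳ-≤ j _ _ (subst₂ _≤_ (reorder j t d) (sym e) strict)
    where
    reorder : ∀ j t d → suc (j + t + d) ≡ t + suc d + j
    reorder = solve-∀
    weak : j + t ≤ w (j + t)
    weak = subst (_≤ w (j + t)) (+-comm t j) (subst (t + j ≤_) e (+-monoˡ-≤ j t≤zt))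
    off-run : w (j + t) ≢ j + t + d
    off-run with t ≟ 0
    ... | yes t≡0 = λ e' → brk (trans (cong w (sym j+0≡j)) (trans e' (cong (_+ d) j+0≡j)))
      where
      j+0≡j : j + t ≡ j
      j+0≡j = trans (cong (j +_) t≡0) (+-identityʳ j)
    ... | no t≢0 = no-run-point-after-break (j + t)
                     (subst (_≤ j + t) (+-comm j 1) (+-monoʳ-≤ j (≤∧≢⇒< z≤n (λ e' → t≢0 (sym e'))))) (shifted< h)
    strict : suc (j + t + d) ≤ w (j + t)
    strict = ≤∧≢⇒< (gap (j + t) (shifted< h) weak) (λ e' → off-run (sym e'))

  dropPrefixRun-admissible : Admissible (suc d) M z
  dropPrefixRun-admissible = record
    { bounded = dropPrefixRun-bounded ; injective = dropPrefixRun-injective ; avoids321 = dropPrefixRun-avoids321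
    ; avoids2143 = dropPrefixRun-avoids2143 ; gap = dropPrefixRun-gap }

insertAt-deleteAt : ∀ m v N (w u : Seq) → m ≤ N → w m ≡ v → AgreeBelow N u (deleteAt m w) →
                    AgreeBelow (suc N) (insertAt m v u) w
insertAt-deleteAt m v N w u m≤N wm≡v u≈ i i<N with <-cmp i m
... | tri< x _ _ = trans (insertAt-lo {m} {v} {u} x) (trans (u≈ i (<-≤-trans x m≤N)) (ifᵈ-yes (i <? m) x))
... | tri≈ _ refl _ = trans (insertAt-eq {m} {v} {u}) (sym wm≡v)
... | tri> _ _ x = trans (insertAt-hi {m} {v} {u} x)
                     (trans (u≈ (pred i) (subst (_≤ N) (sym (<⇒suc-pred x)) (≤-pred i<N)))
                       (trans (ifᵈ-no (pred i <? m) (λ y → <-irrefl refl (<-≤-trans y m≤pred-i))) (cong w (<⇒suc-pred x))))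
  where
  m≤pred-i : m ≤ pred i
  m≤pred-i = ≤-pred (subst (suc m ≤_) (sym (<⇒suc-pred x)) x)

encode-decode : ∀ k d m w → 1 ≤ m → m ≤ k → Admissible d (m + d) w → AgreeBelow (m + d) (encode d (decode k d m w)) w
encode-decode zero d m w 1≤m m≤k A i h = ⊥-elim (<-irrefl refl (≤-trans 1≤m m≤k))
encode-decode (suc k) d zero w () m≤k A i h
encode-decode (suc k) d (suc zero) w _ _ A i h = sym (admissible-single-row d w A i h)
encode-decode (suc k) d (suc (suc m₀)) w _ mk A i h with w (suc m₀) ≟ suc m₀ + d
... | yes on-run = trans (encode-widen d F i)
                     (insertAt-deleteAt (suc m₀) _ (suc m₀ + d) w (encode d F) (m≤m+n (suc m₀) d) on-run IH i h)
  where
  F = decode k d (suc m₀) (deleteAt (suc m₀) w)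
  IH : AgreeBelow (suc m₀ + d) (encode d F) (deleteAt (suc m₀) w)
  IH = encode-decode k d (suc m₀) (deleteAt (suc m₀) w) (s≤s z≤n) (≤-pred mk) (deleteAt-admissible (s≤s z≤n) A on-run)
... | no off with firstBreak d (suc m₀) w
...   | noBreak run = ⊥-elim (off-run-has-break d m₀ w A off run)
...   | breakAt j m₂ j+m₂ run brk =
  trans (cong (λ r → insertRun (j + suc (suc m₂)) r d y i) no-free-gaps) (trans (insertRun-empty (j + suc (suc m₂)) d y i) y≈w)
  where
  open AtFirstBreak d m₀ w A off j m₂ j+m₂ run brk using (z; dropPrefixRun-admissible; raise-dropPrefixRun; j+M≡N)
  G = decode k (suc d) (suc m₂) z
  y = prefixRun d j (encode (suc d) G)
  no-free-gaps : suc (suc m₀) ∸ (j + suc (suc m₂)) ≡ 0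
  no-free-gaps = trans (cong (suc (suc m₀) ∸_) (trans (+-suc j (suc m₂)) (cong suc j+m₂))) (n∸n≡0 (suc (suc m₀)))
  fuel : suc m₂ ≤ k
  fuel = ≤-trans (subst (suc m₂ ≤_) j+m₂ (m≤n+m (suc m₂) j)) (≤-pred mk)
  IH : AgreeBelow (suc m₂ + suc d) (encode (suc d) G) z
  IH = encode-decode k (suc d) (suc m₂) z (s≤s z≤n) fuel dropPrefixRun-admissible
  y≈w : y i ≡ w i
  y≈w with below-or-above i j
  ... | inj₁ x = trans (prefixRun-lo {d} {j} {encode (suc d) G} x) (sym (run i x))
  ... | inj₂ (t , refl) =
        trans (prefixRun-hi {d} {j} {encode (suc d) G} t) (trans (cong (raise d j) (IH t t<M)) (raise-dropPrefixRun t t<M))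
    where
    t<M : t < suc m₂ + suc d
    t<M = +-cancelˡ-< j _ _ (subst (j + t <_) (sym j+M≡N) h)

-- Permutations as words

open Av321-2143

toVec : ∀ n (w : Seq) → Bounded n w → Vec (Fin n) n
toVec n w b = tabulate (λ i → fromℕ< (b (toℕ i) (toℕ<n i)))

toℕ-lookup-toVec : ∀ n w b i → toℕ (lookup (toVec n w b) i) ≡ w (toℕ i)
toℕ-lookup-toVec n w b i = trans (cong toℕ (lookup∘tabulate _ i)) (toℕ-fromℕ< _)

-- Positions ≥ n are junk and read as 0.
fromVec : ∀ n → Vec (Fin n) n → Seq
fromVec n σ i with i <? n
... | yes h = toℕ (lookup σ (fromℕ< h))
... | no _  = 0

fromVec-toℕ : ∀ n σ (k : Fin n) → fromVec n σ (toℕ k) ≡ toℕ (lookup σ k)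
fromVec-toℕ n σ k with toℕ k <? n
... | yes h = cong (λ x → toℕ (lookup σ x)) (fromℕ<-toℕ k h)
... | no h  = ⊥-elim (h (toℕ<n k))

fromVec-< : ∀ n σ i (h : i < n) → fromVec n σ i ≡ toℕ (lookup σ (fromℕ< h))
fromVec-< n σ i h = trans (cong (fromVec n σ) (sym (toℕ-fromℕ< h))) (fromVec-toℕ n σ (fromℕ< h))

toVec-fromVec : ∀ n w b σ → AgreeBelow n w (fromVec n σ) → toVec n w b ≡ σ
toVec-fromVec n w b σ w≈σ = trans (tabulate-cong entry) (tabulate∘lookup σ)
  where
  entry : ∀ k → fromℕ< (b (toℕ k) (toℕ<n k)) ≡ lookup σ k
  entry k = toℕ-injective (trans (toℕ-fromℕ< _) (trans (w≈σ (toℕ k) (toℕ<n k)) (fromVec-toℕ n σ k)))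

fromVec-toVec : ∀ n w b → AgreeBelow n (fromVec n (toVec n w b)) w
fromVec-toVec n w b i h =
  trans (fromVec-< n _ i h) (trans (toℕ-lookup-toVec n w b (fromℕ< h)) (cong w (toℕ-fromℕ< h)))

toAv : ∀ n w → Admissible 0 n w → Av321-2143 n
toAv n w A = perm σ σ-perm σ-avoids321 σ-avoids2143
  where
  open Admissible A
  σ = toVec n w bounded
  σ≡ = toℕ-lookup-toVec n w bounded
  σ-perm : IsPerm σ
  σ-perm i j e = toℕ-injective
    (injective (toℕ i) (toℕ j) (toℕ<n i) (toℕ<n j) (trans (sym (σ≡ i)) (trans (cong toℕ e) (σ≡ j))))
  σ-avoids321 : ¬ Contains321 σ
  σ-avoids321 (i₁ , i₂ , i₃ , i₁<i₂ , i₂<i₃ , d₁ , d₂) =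
    avoids321 (toℕ i₁) (toℕ i₂) (toℕ i₃) i₁<i₂ i₂<i₃ (toℕ<n i₃)
      (subst₂ _<_ (σ≡ i₂) (σ≡ i₁) d₁) (subst₂ _<_ (σ≡ i₃) (σ≡ i₂) d₂)
  σ-avoids2143 : ¬ Contains21-43 σ
  σ-avoids2143 (i₁ , i₂ , i₃ , i₄ , adj , i₂<i₃ , i₃<i₄ , d₁ , d₂ , d₃) =
    avoids2143 (toℕ i₁) (toℕ i₃) (toℕ i₄) (subst (_< toℕ i₃) adj i₂<i₃) i₃<i₄ (toℕ<n i₄)
      (subst (_< w (toℕ i₁)) (cong w adj) (subst₂ _<_ (σ≡ i₂) (σ≡ i₁) d₁))
      (subst₂ _<_ (σ≡ i₁) (σ≡ i₄) d₂) (subst₂ _<_ (σ≡ i₄) (σ≡ i₃) d₃)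

fromAv-admissible : ∀ n (σ : Av321-2143 n) → Admissible 0 n (fromVec n (word σ))
fromAv-admissible n (perm σ σ-perm σ-avoids321 σ-avoids2143) = record
  { bounded = bounded ; injective = injective ; avoids321 = avoids321 ; avoids2143 = avoids2143
  ; gap = λ i _ i≤wi → subst (_≤ w i) (sym (+-identityʳ i)) i≤wi }
  where
  w = fromVec n σ
  w≡ = fromVec-< n σ
  at : ∀ {i} → i < n → Fin n
  at h = fromℕ< h
  at< : ∀ {i i'} (h : i < n) (h' : i' < n) → i < i' → at h F.< at h'
  at< h h' x = subst₂ _<_ (sym (toℕ-fromℕ< h)) (sym (toℕ-fromℕ< h')) x
  σ< : ∀ {i i'} (h : i < n) (h' : i' < n) → w i < w i' → lookup σ (at h) F.< lookup σ (at h')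
  σ< {i} {i'} h h' x = subst₂ _<_ (w≡ i h) (w≡ i' h') x
  bounded : Bounded n w
  bounded i h = subst (_< n) (sym (w≡ i h)) (toℕ<n _)
  injective : InjectiveOn n w
  injective i i' h h' e = trans (sym (toℕ-fromℕ< h)) (trans (cong toℕ at≡) (toℕ-fromℕ< h'))
    where
    at≡ : at h ≡ at h'
    at≡ = recompute (at h F.≟ at h') (σ-perm _ _ (toℕ-injective (trans (sym (w≡ i h)) (trans e (w≡ i' h')))))
  avoids321 : Avoids321 n w
  avoids321 i j k i<j j<k k<n d₁ d₂ =
    ⊥-recompute (σ-avoids321 (at i<n , at j<n , at k<n , at< i<n j<n i<j , at< j<n k<n j<k , σ< j<n i<n d₁ , σ< k<n j<n d₂))
    where
    j<n = <-trans j<k k<n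
    i<n = <-trans i<j j<n
  avoids2143 : Avoids2143 n w
  avoids2143 a c e sa<c c<e e<n d₁ d₂ d₃ =
    ⊥-recompute (σ-avoids2143 (at a<n , at sa<n , at c<n , at e<n , adj , at< sa<n c<n sa<c , at< c<n e<n c<e
                              , σ< sa<n a<n d₁ , σ< a<n e<n d₂ , σ< e<n c<n d₃))
    where
    c<n = <-trans c<e e<n
    sa<n = <-trans sa<c c<n
    a<n = <-trans (n<1+n a) sa<n
    adj : toℕ (at sa<n) ≡ suc (toℕ (at a<n))
    adj = trans (toℕ-fromℕ< sa<n) (cong suc (sym (toℕ-fromℕ< a<n)))

Av321-2143-≡ : ∀ {n} (x y : Av321-2143 n) → word x ≡ word y → x ≡ y
Av321-2143-≡ (perm w _ _ _) (perm .w _ _ _) refl = refl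

encode-admissible₀ : ∀ {n} (F : BlockFountain n) → 1 ≤ n → Admissible 0 n (encode 0 F)
encode-admissible₀ {n} F 1≤n =
  subst (λ k → Admissible 0 k (encode 0 F)) (+-identityʳ n) (proj₁ (encode-admissible 0 n F 1≤n))

encode-decode₀ : ∀ n w → 1 ≤ n → Admissible 0 n w → AgreeBelow n (encode 0 (decode n 0 n w)) w
encode-decode₀ n w 1≤n A i h = encode-decode n 0 n w 1≤n ≤-refl
  (subst (λ k → Admissible 0 k w) (sym (+-identityʳ n)) A) i (subst (i <_) (sym (+-identityʳ n)) h)

decode-encode₀ : ∀ n (F : BlockFountain n) → 1 ≤ n → ∀ w → AgreeBelow n w (encode 0 F) → decode n 0 n w ≡ F
decode-encode₀ n F 1≤n w hw = decode-encode n 0 n F 1≤n ≤-refl w (λ i h → hw i (subst (i <_) (+-identityʳ n) h))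

mainTheorem5 : ∀ (n : ℕ) → 1 ≤ n → BlockFountain n ⤖ Av321-2143 n
mainTheorem5 n 1≤n = ↔⇒⤖ (mk↔ₛ′ to from to∘from from∘to)
  where
  bounded : ∀ F → Bounded n (encode 0 F)
  bounded F = Admissible.bounded (encode-admissible₀ F 1≤n)
  to : BlockFountain n → Av321-2143 n
  to F = toAv n (encode 0 F) (encode-admissible₀ F 1≤n)
  from : Av321-2143 n → BlockFountain n
  from σ = decode n 0 n (fromVec n (word σ))
  to∘from : ∀ σ → to (from σ) ≡ σ
  to∘from σ = Av321-2143-≡ (to (from σ)) σ
    (toVec-fromVec n (encode 0 (from σ)) (bounded (from σ)) (word σ)
      (encode-decode₀ n (fromVec n (word σ)) 1≤n (fromAv-admissible n σ)))
  from∘to : ∀ F → from (to F) ≡ F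
  from∘to F = decode-encode₀ n F 1≤n (fromVec n (word (to F))) (fromVec-toVec n (encode 0 F) (bounded F))
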